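{- Let $n\ge 2$ and let $p_1,\ldots,p_n$ be positive integers such that $p_1+\cdots+p_r=p_{r+1}+\cdots+p_n=p\ge 4$ for some integer $r$. Let $G=K(p_1,p_2,\ldots,p_n,q)$. Then $\bar d(G)=2$ if either $p$ is even and $p+2\le q\le \Phi_{even}(p)+2$, or $p$ is odd and $p+3\le q\le \Phi_{odd}(p)+2$.
   Context: $K(p_1,\ldots,p_n,q)$ is the complete $(n+1)$-partite graph with partite sets of sizes $p_1,\ldots,p_n,q$. The orientation number $\bar d(G)$ of a connected bridgeless graph $G$ is the minimum of the diameter $d(D)$ over all strong orientations $D$ of $G$, where $d(D)$ is the maximum over ordered pairs of vertices of the length of a shortest directed path. For even $p$, $\Phi_{even}(p)=\sum\binom{p/2}{x_1}\binom{p/2}{x_2}\binom{p/2}{x_3}\binom{p/2}{x_4}$ over all integer tuples with $x_1+x_2+x_3+x_4=p$ and $1\le x_r\le p/2-1$ for all $r$; equivalently $\Phi_{even}(p)=\binom{2p}{p}-8\binom{3p/2}{p}+12\binom{p}{p/2}-6$. For odd $p$, with $x=\lfloor p/2\rfloor$, $\Phi_{odd}(p)=\sum\binom{x+1}{x_1}\binom{x+1}{x_2}\binom{x}{x_3}\binom{x}{x_4}$ over all integer tuples $(x_1,x_2,x_3,x_4)$ with $x_1+x_2+x_3+x_4=p$, $1\le x_1,x_2\le x$, and $1\le x_3,x_4\le x-1$. -}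

module Defs where

open import Data.Nat using (ℕ; zero; suc; _+_; _*_; _∸_; _≤_; _<_; _/_; _≡ᵇ_)
open import Data.Nat.Combinatorics using (_C_)
open import Data.Bool using (Bool; true; false; if_then_else_)
open import Data.Fin using (Fin)
open import Data.Product using (Σ; ∃; ∃-syntax; _×_; _,_; proj₁)
open import Data.Sum using (_⊎_)
open import Data.Nat.ListAction using (sum)
open import Data.List using (List; map; upTo; take; drop; tabulate; concatMap)
open import Data.Vec.Functional using (_++_)
open import Relation.Binary.PropositionalEquality using (_≡_)
open import Relation.Nullary using (¬_)

Digraph : Set → Set
Digraph V = V → V → Bool

Arc : {V : Set} → Digraph V → V → V → Set
Arc D u v = D u v ≡ true

IsOrientation : {V : Set} → (V → V → Set) → Digraph V → Set
IsOrientation {V} Adj D =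
  (∀ (u v : V) → Adj u v → Arc D u v ⊎ Arc D v u) ×
  (∀ (u v : V) → Arc D u v → Adj u v) ×
  (∀ (u v : V) → Arc D u v → ¬ Arc D v u)

data Walk {V : Set} (D : Digraph V) : ℕ → V → V → Set where
  here : ∀ {u} → Walk D zero u u
  step : ∀ {m u w v} → Arc D u w → Walk D m w v → Walk D (suc m) u v

IsStrong : {V : Set} → Digraph V → Set
IsStrong {V} D = ∀ (u v : V) → ∃[ m ] Walk D m u v

HasDiameter : {V : Set} → Digraph V → ℕ → Set
HasDiameter {V} D k =
  IsStrong D ×
  (∀ (u v : V) → ∃[ m ] (m ≤ k × Walk D m u v)) ×
  (∃[ u ] ∃[ v ] (∀ m → m < k → ¬ Walk D m u v))

OrientationNumber : {V : Set} → (V → V → Set) → ℕ → Set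
OrientationNumber {V} Adj k =
  (∃[ D ] (IsOrientation Adj D × HasDiameter D k)) ×
  (∀ (D : Digraph V) (j : ℕ) → IsOrientation Adj D → HasDiameter D j → k ≤ j)

MPVertex : {m : ℕ} → (Fin m → ℕ) → Set
MPVertex {m} sizes = Σ (Fin m) (λ i → Fin (sizes i))

MPAdj : {m : ℕ} (sizes : Fin m → ℕ) → MPVertex sizes → MPVertex sizes → Set
MPAdj sizes u v = ¬ (proj₁ u ≡ proj₁ v)

KSizes : {n : ℕ} → (Fin n → ℕ) → ℕ → Fin (n + 1) → ℕ
KSizes p q = p ++ (λ _ → q)

range1 : ℕ → List ℕ
range1 u = map suc (upTo u)

Φgen : (m1 m2 m3 m4 u1 u2 u3 u4 p : ℕ) → ℕ
Φgen m1 m2 m3 m4 u1 u2 u3 u4 p =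
  sum (concatMap (λ x1 → concatMap (λ x2 → concatMap (λ x3 → map (λ x4 →
        if (x1 + x2 + x3 + x4) ≡ᵇ p
        then (m1 C x1) * (m2 C x2) * (m3 C x3) * (m4 C x4)
        else 0)
      (range1 u4)) (range1 u3)) (range1 u2)) (range1 u1))

Φeven : ℕ → ℕ
Φeven p = Φgen h h h h (h ∸ 1) (h ∸ 1) (h ∸ 1) (h ∸ 1) p
  where h = p / 2

Φodd : ℕ → ℕ
Φodd p = Φgen (x + 1) (x + 1) x x x x (x ∸ 1) (x ∸ 1) p
  where x = p / 2

prefixSum : {n : ℕ} → (Fin n → ℕ) → ℕ → ℕ
prefixSum p r = sum (take r (tabulate p))

suffixSum : {n : ℕ} → (Fin n → ℕ) → ℕ → ℕ
suffixSum p r = sum (drop r (tabulate p))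

-- Write p = M + N with M = ⌈p/2⌉ and N = ⌊p/2⌋. The vertices of the first r parts form the left
-- side, the others the right side, and each side is cut into a large block of M and a small block
-- of N vertices. Across the sides the four blocks are oriented as the directed 4-cycle
-- (left,large) → (right,large) → (left,small) → (right,small) → (left,large); within a side, arcs
-- go from lower to higher parts. A vertex of the q-part is described by the set of p-vertices it
-- points to. If this set meets every block in a nonempty proper subset, the vertex reaches every
-- p-vertex and is reached from it within two steps through a neighbouring block, and two such
-- sets of size p each contain a vertex the other lacks; Φ(p) counts them. The two sides as sets,
-- and 2M core sets (on the left all but one vertex of each block, on the right just those two),
-- separate all pairs of p-vertices. Together with the sets counted by Φ(p) there are at least
-- Φ(p) + 2 ≥ q ≥ 2M + 2 of them, enough for every vertex of the q-part. An arc cannot be reversed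
-- by a walk shorter than two, so no orientation does better.

module Submission where

open import Defs
open import Data.Nat using (ℕ; _≤_; _+_; _%_; _<_)
open import Data.Fin using (Fin)
open import Data.Product using (_×_; ∃-syntax)
open import Data.Sum using (_⊎_)
open import Relation.Binary.PropositionalEquality using (_≡_)

open import Data.Nat
  using (zero; suc; pred; _*_; _∸_; _/_; z≤n; s≤s; s≤s⁻¹; NonZero; >-nonZero; _≡ᵇ_)
open import Data.Nat.Properties
  using (≤-refl; ≤-reflexive; ≤-trans; ≤-<-trans; ≤-antisym; <⇒≤; ≮⇒≥; n<1+n; 1+n≢n; 1+n≰n;
         suc-injective; suc-pred; m≤m+n; m<m+n; +-comm; +-assoc; +-identityʳ; *-assoc;
         +-monoʳ-≤; +-monoˡ-≤; +-monoʳ-<; m∸n+n≡m; m<n⇒0<n∸m; ∸-monoʳ-<; ≡ᵇ⇒≡; module ≤-Reasoning)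
import Data.Nat.Properties as ℕ
open import Data.Nat.DivMod using (_mod_; m%n<n; m<n⇒m%n≡m; %-distribˡ-+; n%n≡0; m≡m%n+[m/n]*n)
open import Data.Nat.Combinatorics using (_C_; nCk+nC[k+1]≡[n+1]C[k+1])
open import Data.Nat.ListAction using (sum)
open import Data.Nat.ListAction.Properties using (sum-++)
open import Data.Nat.Tactic.RingSolver using (solve-∀)
open import Data.Bool using (Bool; true; false; not; if_then_else_; T)
open import Data.Bool.Properties using (not-¬)
import Data.Bool as Bool
open import Data.Fin
  using (zero; suc; toℕ; fromℕ<; inject≤; reduce≥; splitAt; _↑ˡ_; _↑ʳ_; cast)
open import Data.Fin.Properties
  using (_≟_; _<?_; <-cmp; <-irrefl; toℕ<n; toℕ-injective; toℕ-fromℕ<; toℕ-inject≤; toℕ-↑ˡ; toℕ-↑ʳ;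
         toℕ-cast; cast-involutive; inject≤-injective; inject≤-idempotent; injective⇒≤; ↑ˡ-injective;
         +↔⊎; splitAt-<; splitAt-≥; splitAt-↑ˡ; splitAt-↑ʳ; splitAt⁻¹-↑ˡ; splitAt⁻¹-↑ʳ)
open import Data.Fin.Subset using (Subset; inside; outside; ∣_∣; ⊤; ⊥; ⁅_⁆; ∁)
open import Data.Fin.Subset.Properties using (∣⊤∣≡n; ∣⊥∣≡0; ∣⁅x⁆∣≡1; ∣∁p∣≡n∸∣p∣)
open import Data.Vec using (Vec; []; _∷_; lookup)
import Data.Vec as Vec
open import Data.Vec.Properties
  using (∷-injectiveʳ; lookup-replicate; lookup-map; lookup-splitAt; ++-injective)
import Data.Vec.Properties as Vec
import Data.Vec.Functional as Vector
open import Data.List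
  using (List; []; _∷_; _++_; map; concatMap; length; cartesianProduct; tabulate; filter; take)
import Data.List as List
open import Data.List.Properties
  using (length-++; length-++-≤ˡ; length-map; length-tabulate; take++drop≡id)
open import Data.List.Membership.Propositional using (_∈_)
open import Data.List.Membership.Propositional.Properties
  using (∈-map⁻; ∈-++⁺ˡ; ∈-++⁺ʳ; ∈-++⁻; ∈-upTo⁻; ∈-cartesianProduct⁻; ∈-lookup;
         ∈-tabulate⁺; ∈-tabulate⁻; ∈-filter⁺; ∈-filter⁻)
import Data.List.Membership.DecPropositional as DecMembership
open import Data.List.Relation.Unary.All as All using (All; []; _∷_)
import Data.List.Relation.Unary.All.Properties as All
open import Data.List.Relation.Unary.Any as Any using (here; there)
open import Data.List.Relation.Unary.Any.Properties using (lookup-index)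
open import Data.List.Relation.Unary.AllPairs using ([]; _∷_)
open import Data.List.Relation.Unary.Unique.Propositional using (Unique)
import Data.List.Relation.Unary.Unique.Propositional.Properties as Unique
open import Data.List.Relation.Binary.Disjoint.Propositional using (Disjoint)
open import Data.Product using (Σ; _,_; proj₁; proj₂)
import Data.Product as Product
import Data.Product.Properties as Product
open import Data.Sum using (inj₁; inj₂; [_,_]′)
open import Data.Sum.Function.Propositional using (_⊎-↔_)
open import Data.Empty using (⊥-elim)
open import Function using (id; _∘_; _↔_; Inverse; mk↔ₛ′)
open import Function.Construct.Composition using (_↔-∘_)
open import Relation.Binary.PropositionalEquality
  using (_≢_; refl; sym; trans; cong; cong₂; subst; subst₂; module ≡-Reasoning)
open import Relation.Binary.Definitions using (DecidableEquality; tri<; tri≈; tri>)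
open import Relation.Nullary using (¬_; yes; no; does; ¬?)
open import Relation.Nullary.Decidable using (dec-true; dec-false)

-- Orientations of diameter two

module _ {V : Set} {Adj : V → V → Set} (irreflexive : ∀ {w} → ¬ Adj w w) where

  arc⇒noShortReturn : ∀ {D u v} → IsOrientation Adj D → Arc D u v →
                      ∀ m → m < 2 → ¬ Walk D m v u
  arc⇒noShortReturn (_ , arc⇒adj , _) uv zero _ here = irreflexive (arc⇒adj _ _ uv)
  arc⇒noShortReturn (_ , _ , asym) uv 1 _ (step vu here) = asym _ _ uv vu
  arc⇒noShortReturn _ _ (suc (suc _)) (s≤s (s≤s ())) _

  edge⇒farPair : ∀ {D u v} → Adj u v → IsOrientation Adj D →
                 ∃[ x ] ∃[ y ] (∀ m → m < 2 → ¬ Walk D m x y)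
  edge⇒farPair {u = u} {v} uv o@(oriented , _) with oriented u v uv
  ... | inj₁ arc = v , u , arc⇒noShortReturn o arc
  ... | inj₂ arc = u , v , arc⇒noShortReturn o arc

  orientationNumber≡2 : ∀ (D : Digraph V) {u v} → Adj u v → IsOrientation Adj D →
                        (∀ x y → ∃[ m ] (m ≤ 2 × Walk D m x y)) →
                        OrientationNumber Adj 2
  orientationNumber≡2 D uv o within2 =
    (D , o , strong , within2 , edge⇒farPair uv o) , lowerBound
    where
    strong : IsStrong D
    strong x y with within2 x y
    ... | m , _ , walk = m , walk
    lowerBound : ∀ D′ j → IsOrientation Adj D′ → HasDiameter D′ j → 2 ≤ j
    lowerBound D′ j o′ (_ , within , _) with edge⇒farPair uv o′
    ... | x , y , far with within x y
    ... | m , m≤j , walk = ≤-trans (≮⇒≥ λ m<2 → far m m<2 walk) m≤j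

true≢false : true ≢ false
true≢false ()

∃-inside : ∀ {n} (p : Subset n) → 0 < ∣ p ∣ → ∃[ x ] (lookup p x ≡ inside)
∃-inside (inside ∷ p) _ = zero , refl
∃-inside (outside ∷ p) 0<∣p∣ = Product.map suc id (∃-inside p 0<∣p∣)

∃-outside : ∀ {n} (p : Subset n) → ∣ p ∣ < n → ∃[ x ] (lookup p x ≡ outside)
∃-outside (outside ∷ p) _ = zero , refl
∃-outside (inside ∷ p) (s≤s ∣p∣<n) = Product.map suc id (∃-outside p ∣p∣<n)

∃-inside-outside : ∀ {n} (p q : Subset n) → ∣ q ∣ ≤ ∣ p ∣ → p ≢ q →
                   ∃[ x ] (lookup p x ≡ inside × lookup q x ≡ outside)
∃-inside-outside [] [] _ p≢q = ⊥-elim (p≢q refl)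
∃-inside-outside (inside ∷ p) (outside ∷ q) _ _ = zero , refl , refl
∃-inside-outside (inside ∷ p) (inside ∷ q) (s≤s ∣q∣≤∣p∣) p≢q =
  Product.map suc id (∃-inside-outside p q ∣q∣≤∣p∣ (p≢q ∘ cong (inside ∷_)))
∃-inside-outside (outside ∷ p) (outside ∷ q) ∣q∣≤∣p∣ p≢q =
  Product.map suc id (∃-inside-outside p q ∣q∣≤∣p∣ (p≢q ∘ cong (outside ∷_)))
∃-inside-outside (outside ∷ p) (inside ∷ q) ∣q∣<∣p∣ _ =
  Product.map suc id (∃-inside-outside p q (<⇒≤ ∣q∣<∣p∣) λ { refl → 1+n≰n ∣q∣<∣p∣ })

∣++∣ : ∀ {m n} (p : Subset m) (q : Subset n) → ∣ p Vec.++ q ∣ ≡ ∣ p ∣ + ∣ q ∣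
∣++∣ [] q = refl
∣++∣ (inside ∷ p) q = cong suc (∣++∣ p q)
∣++∣ (outside ∷ p) q = ∣++∣ p q

Proper : ∀ {n} → Subset n → Set
Proper {n} p = 0 < ∣ p ∣ × ∣ p ∣ < n

lookup-⁅⁆-self : ∀ {n} (x : Fin n) → lookup ⁅ x ⁆ x ≡ inside
lookup-⁅⁆-self zero = refl
lookup-⁅⁆-self (suc x) = lookup-⁅⁆-self x

lookup-⁅⁆-other : ∀ {n} {x z : Fin n} → z ≢ x → lookup ⁅ x ⁆ z ≡ outside
lookup-⁅⁆-other {x = zero} {zero} z≢x = ⊥-elim (z≢x refl)
lookup-⁅⁆-other {x = zero} {suc z} _ = lookup-replicate z outside
lookup-⁅⁆-other {x = suc x} {zero} _ = refl
lookup-⁅⁆-other {x = suc x} {suc z} z≢x = lookup-⁅⁆-other (z≢x ∘ cong suc)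

⁅⁆-injective : ∀ {n} {x x′ : Fin n} → ⁅ x ⁆ ≡ ⁅ x′ ⁆ → x ≡ x′
⁅⁆-injective {x = x} {x′} eq with x ≟ x′
... | yes x≡x′ = x≡x′
... | no x≢x′ with () ←
  trans (sym (lookup-⁅⁆-self x)) (trans (cong (λ p → lookup p x) eq) (lookup-⁅⁆-other x≢x′))

Proper-⁅⁆ : ∀ {n} → 2 ≤ n → (x : Fin n) → Proper ⁅ x ⁆
Proper-⁅⁆ 2≤n x rewrite ∣⁅x⁆∣≡1 x = s≤s z≤n , 2≤n

Proper-∁ : ∀ {n} {p : Subset n} → Proper p → Proper (∁ p)
Proper-∁ {p = p} (0<∣p∣ , ∣p∣<n) rewrite ∣∁p∣≡n∸∣p∣ p = m<n⇒0<n∸m ∣p∣<n , ∸-monoʳ-< 0<∣p∣ (<⇒≤ ∣p∣<n)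

module _ {A B : Set} where

  length-concatMap-map : (f : A → List B) (g : A → ℕ) → (∀ x → length (f x) ≡ g x) →
                         ∀ xs → length (concatMap f xs) ≡ sum (map g xs)
  length-concatMap-map f g eq [] = refl
  length-concatMap-map f g eq (x ∷ xs) =
    trans (length-++ (f x)) (cong₂ _+_ (eq x) (length-concatMap-map f g eq xs))

  length-concatMap-concatMap : (f : A → List B) (g : A → List ℕ) → (∀ x → length (f x) ≡ sum (g x)) →
                               ∀ xs → length (concatMap f xs) ≡ sum (concatMap g xs)
  length-concatMap-concatMap f g eq [] = refl
  length-concatMap-concatMap f g eq (x ∷ xs) = begin
    length (f x ++ concatMap f xs)          ≡⟨ length-++ (f x) ⟩
    length (f x) + length (concatMap f xs)  ≡⟨ cong₂ _+_ (eq x) (length-concatMap-concatMap f g eq xs) ⟩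
    sum (g x) + sum (concatMap g xs)        ≡⟨ sum-++ (g x) (concatMap g xs) ⟨
    sum (g x ++ concatMap g xs)             ∎
    where open ≡-Reasoning

  All-concatMap⁺ : ∀ {P : B → Set} {f : A → List B} {xs} →
                   (∀ {x} → x ∈ xs → All P (f x)) → All P (concatMap f xs)
  All-concatMap⁺ {xs = []} _ = []
  All-concatMap⁺ {xs = x ∷ xs} all = All.++⁺ (all (here refl)) (All-concatMap⁺ (all ∘ there))

  Unique-concatMap⁺ : ∀ (key : B → A) {f : A → List B} {xs} → Unique xs →
                      (∀ x → Unique (f x)) → (∀ x → All (λ y → key y ≡ x) (f x)) →
                      Unique (concatMap f xs)
  Unique-concatMap⁺ key {xs = []} _ _ _ = []
  Unique-concatMap⁺ key {f} {x ∷ xs} (x∉xs ∷ unique) unique-f keys =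
    Unique.++⁺ (unique-f x) (Unique-concatMap⁺ key unique unique-f keys) disjoint
    where
    keys∈xs : All (λ y → key y ∈ xs) (concatMap f xs)
    keys∈xs = All-concatMap⁺ {f = f} λ {x′} x′∈xs → All.map (λ { refl → x′∈xs }) (keys x′)
    disjoint : Disjoint (f x) (concatMap f xs)
    disjoint (y∈fx , y∈rest) =
      All.lookup x∉xs (All.lookup keys∈xs y∈rest) (sym (All.lookup (keys x) y∈fx))

  length-cartesianProduct : ∀ (xs : List A) (ys : List B) →
                            length (cartesianProduct xs ys) ≡ length xs * length ys
  length-cartesianProduct [] ys = refl
  length-cartesianProduct (x ∷ xs) ys =
    trans (length-++ (map (x ,_) ys)) (cong₂ _+_ (length-map _ ys) (length-cartesianProduct xs ys))

module _ {A : Set} where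

  Unique⇒lookup-injective : ∀ {xs : List A} → Unique xs →
                            ∀ {i j} → List.lookup xs i ≡ List.lookup xs j → i ≡ j
  Unique⇒lookup-injective {_ ∷ _} _ {zero} {zero} _ = refl
  Unique⇒lookup-injective {_ ∷ _} (x∉xs ∷ _) {zero} {suc j} x≡ = ⊥-elim (All.lookup x∉xs (∈-lookup j) x≡)
  Unique⇒lookup-injective {_ ∷ _} (x∉xs ∷ _) {suc i} {zero} ≡x =
    ⊥-elim (All.lookup x∉xs (∈-lookup i) (sym ≡x))
  Unique⇒lookup-injective {_ ∷ _} (_ ∷ unique) {suc i} {suc j} eq =
    cong suc (Unique⇒lookup-injective unique eq)

  Unique⇒length≤ : ∀ {xs ys : List A} → Unique xs → (∀ {x} → x ∈ xs → x ∈ ys) → length xs ≤ length ys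
  Unique⇒length≤ {xs} {ys} unique xs⊆ys = injective⇒≤ position-injective
    where
    position : Fin (length xs) → Fin (length ys)
    position i = Any.index (xs⊆ys (∈-lookup i))
    position-injective : ∀ {i j} → position i ≡ position j → i ≡ j
    position-injective {i} {j} eq = Unique⇒lookup-injective unique (begin
      List.lookup xs i          ≡⟨ lookup-index (xs⊆ys (∈-lookup i)) ⟩
      List.lookup ys (position i) ≡⟨ cong (List.lookup ys) eq ⟩
      List.lookup ys (position j) ≡⟨ lookup-index (xs⊆ys (∈-lookup j)) ⟨
      List.lookup xs j          ∎)
      where open ≡-Reasoning

  lookup-++-inject≤ : ∀ (xs ys : List A) i .(le : length xs ≤ length (xs ++ ys)) →
                      List.lookup (xs ++ ys) (inject≤ i le) ≡ List.lookup xs i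
  lookup-++-inject≤ (x ∷ xs) ys zero _ = refl
  lookup-++-inject≤ (x ∷ xs) ys (suc i) le = lookup-++-inject≤ xs ys i (s≤s⁻¹ le)

-- Counting subsets

subsetsOfSize : (n k : ℕ) → List (Subset n)
subsetsOfSize zero zero = [] ∷ []
subsetsOfSize zero (suc k) = []
subsetsOfSize (suc n) zero = map (outside ∷_) (subsetsOfSize n zero)
subsetsOfSize (suc n) (suc k) =
  map (outside ∷_) (subsetsOfSize n (suc k)) ++ map (inside ∷_) (subsetsOfSize n k)

length-subsetsOfSize : ∀ n k → length (subsetsOfSize n k) ≡ (n C k)
length-subsetsOfSize zero zero = refl
length-subsetsOfSize zero (suc k) = refl
length-subsetsOfSize (suc n) zero =
  trans (length-map _ (subsetsOfSize n zero)) (length-subsetsOfSize n zero)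
length-subsetsOfSize (suc n) (suc k) = begin
  length (map (outside ∷_) (subsetsOfSize n (suc k)) ++ map (inside ∷_) (subsetsOfSize n k))
    ≡⟨ length-++ (map (outside ∷_) (subsetsOfSize n (suc k))) ⟩
  length (map (outside ∷_) (subsetsOfSize n (suc k))) + length (map (inside ∷_) (subsetsOfSize n k))
    ≡⟨ cong₂ _+_ (length-map _ (subsetsOfSize n (suc k))) (length-map _ (subsetsOfSize n k)) ⟩
  length (subsetsOfSize n (suc k)) + length (subsetsOfSize n k)
    ≡⟨ cong₂ _+_ (length-subsetsOfSize n (suc k)) (length-subsetsOfSize n k) ⟩
  (n C suc k) + (n C k)
    ≡⟨ +-comm (n C suc k) (n C k) ⟩
  (n C k) + (n C suc k)
    ≡⟨ nCk+nC[k+1]≡[n+1]C[k+1] n k ⟩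
  (suc n C suc k) ∎
  where open ≡-Reasoning

∈-subsetsOfSize⇒size : ∀ {n k p} → p ∈ subsetsOfSize n k → ∣ p ∣ ≡ k
∈-subsetsOfSize⇒size {zero} {zero} (here refl) = refl
∈-subsetsOfSize⇒size {suc n} {zero} p∈ with ∈-map⁻ (outside ∷_) p∈
... | _ , p′∈ , refl = ∈-subsetsOfSize⇒size p′∈
∈-subsetsOfSize⇒size {suc n} {suc k} p∈ with ∈-++⁻ (map (outside ∷_) (subsetsOfSize n (suc k))) p∈
... | inj₁ p∈ˡ with ∈-map⁻ (outside ∷_) p∈ˡ
...   | _ , p′∈ , refl = ∈-subsetsOfSize⇒size p′∈
∈-subsetsOfSize⇒size {suc n} {suc k} _ | inj₂ p∈ʳ with ∈-map⁻ (inside ∷_) p∈ʳ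
...   | _ , p′∈ , refl = cong suc (∈-subsetsOfSize⇒size p′∈)

Unique-subsetsOfSize : ∀ n k → Unique (subsetsOfSize n k)
Unique-subsetsOfSize zero zero = [] ∷ []
Unique-subsetsOfSize zero (suc k) = []
Unique-subsetsOfSize (suc n) zero = Unique.map⁺ ∷-injectiveʳ (Unique-subsetsOfSize n zero)
Unique-subsetsOfSize (suc n) (suc k) =
  Unique.++⁺ (Unique.map⁺ ∷-injectiveʳ (Unique-subsetsOfSize n (suc k)))
             (Unique.map⁺ ∷-injectiveʳ (Unique-subsetsOfSize n k))
             disjoint
  where
  disjoint : Disjoint (map (outside ∷_) (subsetsOfSize n (suc k))) (map (inside ∷_) (subsetsOfSize n k))
  disjoint (v∈ˡ , v∈ʳ) with ∈-map⁻ (outside ∷_) v∈ˡ | ∈-map⁻ (inside ∷_) v∈ʳ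
  ... | _ , _ , refl | _ , _ , ()

InRange : ℕ → ℕ → Set
InRange u x = 1 ≤ x × x ≤ u

∈-range1⇒InRange : ∀ {u x} → x ∈ range1 u → InRange u x
∈-range1⇒InRange {u} x∈ with ∈-map⁻ suc x∈
... | y , y∈upTo , refl = s≤s z≤n , ∈-upTo⁻ y∈upTo

Unique-range1 : ∀ u → Unique (range1 u)
Unique-range1 u = Unique.map⁺ suc-injective (Unique.upTo⁺ u)

Quadruple : (m₁ m₂ m₃ m₄ : ℕ) → Set
Quadruple m₁ m₂ m₃ m₄ = Subset m₁ × Subset m₂ × Subset m₃ × Subset m₄

sizes : ∀ {m₁ m₂ m₃ m₄} → Quadruple m₁ m₂ m₃ m₄ → ℕ × ℕ × ℕ × ℕ
sizes (X₁ , X₂ , X₃ , X₄) = ∣ X₁ ∣ , ∣ X₂ ∣ , ∣ X₃ ∣ , ∣ X₄ ∣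

module Enumeration (m₁ m₂ m₃ m₄ u₁ u₂ u₃ u₄ p : ℕ) where

  Quad : Set
  Quad = Quadruple m₁ m₂ m₃ m₄

  quadruplesOfSizes : ℕ → ℕ → ℕ → ℕ → List Quad
  quadruplesOfSizes x₁ x₂ x₃ x₄ =
    cartesianProduct (subsetsOfSize m₁ x₁) (cartesianProduct (subsetsOfSize m₂ x₂)
      (cartesianProduct (subsetsOfSize m₃ x₃) (subsetsOfSize m₄ x₄)))

  block : ℕ → ℕ → ℕ → ℕ → List Quad
  block x₁ x₂ x₃ x₄ = if (x₁ + x₂ + x₃ + x₄) ≡ᵇ p then quadruplesOfSizes x₁ x₂ x₃ x₄ else []

  level₃ : ℕ → ℕ → ℕ → List Quad
  level₃ x₁ x₂ x₃ = concatMap (block x₁ x₂ x₃) (range1 u₄)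

  level₂ : ℕ → ℕ → List Quad
  level₂ x₁ x₂ = concatMap (level₃ x₁ x₂) (range1 u₃)

  level₁ : ℕ → List Quad
  level₁ x₁ = concatMap (level₂ x₁) (range1 u₂)

  enumeration : List Quad
  enumeration = concatMap level₁ (range1 u₁)

  length-quadruplesOfSizes : ∀ x₁ x₂ x₃ x₄ →
    length (quadruplesOfSizes x₁ x₂ x₃ x₄) ≡ (m₁ C x₁) * (m₂ C x₂) * (m₃ C x₃) * (m₄ C x₄)
  length-quadruplesOfSizes x₁ x₂ x₃ x₄ = begin
    length (quadruplesOfSizes x₁ x₂ x₃ x₄)
      ≡⟨ length-cartesianProduct S₁ _ ⟩
    length S₁ * length (cartesianProduct S₂ (cartesianProduct S₃ S₄))
      ≡⟨ cong (length S₁ *_) (length-cartesianProduct S₂ _) ⟩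
    length S₁ * (length S₂ * length (cartesianProduct S₃ S₄))
      ≡⟨ cong (λ n → length S₁ * (length S₂ * n)) (length-cartesianProduct S₃ S₄) ⟩
    length S₁ * (length S₂ * (length S₃ * length S₄))
      ≡⟨ cong₂ _*_ (length-subsetsOfSize m₁ x₁) (cong₂ _*_ (length-subsetsOfSize m₂ x₂)
           (cong₂ _*_ (length-subsetsOfSize m₃ x₃) (length-subsetsOfSize m₄ x₄))) ⟩
    (m₁ C x₁) * ((m₂ C x₂) * ((m₃ C x₃) * (m₄ C x₄)))
      ≡⟨ *-assoc (m₁ C x₁) (m₂ C x₂) _ ⟨
    (m₁ C x₁) * (m₂ C x₂) * ((m₃ C x₃) * (m₄ C x₄))
      ≡⟨ *-assoc ((m₁ C x₁) * (m₂ C x₂)) (m₃ C x₃) _ ⟨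
    (m₁ C x₁) * (m₂ C x₂) * (m₃ C x₃) * (m₄ C x₄) ∎
    where
    open ≡-Reasoning
    S₁ : List (Subset m₁)
    S₁ = subsetsOfSize m₁ x₁
    S₂ : List (Subset m₂)
    S₂ = subsetsOfSize m₂ x₂
    S₃ : List (Subset m₃)
    S₃ = subsetsOfSize m₃ x₃
    S₄ : List (Subset m₄)
    S₄ = subsetsOfSize m₄ x₄

  length-block : ∀ x₁ x₂ x₃ x₄ → length (block x₁ x₂ x₃ x₄) ≡
    (if (x₁ + x₂ + x₃ + x₄) ≡ᵇ p then (m₁ C x₁) * (m₂ C x₂) * (m₃ C x₃) * (m₄ C x₄) else 0)
  length-block x₁ x₂ x₃ x₄ with (x₁ + x₂ + x₃ + x₄) ≡ᵇ p
  ... | false = refl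
  ... | true = length-quadruplesOfSizes x₁ x₂ x₃ x₄

  length-enumeration : length enumeration ≡ Φgen m₁ m₂ m₃ m₄ u₁ u₂ u₃ u₄ p
  length-enumeration =
    length-concatMap-concatMap _ _ (λ x₁ → length-concatMap-concatMap _ _ (λ x₂ →
      length-concatMap-concatMap _ _ (λ x₃ → length-concatMap-map _ _ (length-block x₁ x₂ x₃)
        (range1 u₄)) (range1 u₃)) (range1 u₂)) (range1 u₁)

  InBlock : ℕ → ℕ → ℕ → ℕ → Quad → Set
  InBlock x₁ x₂ x₃ x₄ t = sizes t ≡ (x₁ , x₂ , x₃ , x₄) × x₁ + x₂ + x₃ + x₄ ≡ p

  All-InBlock : ∀ x₁ x₂ x₃ x₄ → All (InBlock x₁ x₂ x₃ x₄) (block x₁ x₂ x₃ x₄)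
  All-InBlock x₁ x₂ x₃ x₄ with (x₁ + x₂ + x₃ + x₄) ≡ᵇ p in eq
  ... | false = []
  ... | true = All.tabulate λ t∈ → sizes≡ t∈ , ≡ᵇ⇒≡ _ _ (subst T (sym eq) _)
    where
    sizes≡ : ∀ {t} → t ∈ quadruplesOfSizes x₁ x₂ x₃ x₄ → sizes t ≡ (x₁ , x₂ , x₃ , x₄)
    sizes≡ t∈ =
      let X₁∈ , t′∈ = ∈-cartesianProduct⁻ _ _ t∈
          X₂∈ , t″∈ = ∈-cartesianProduct⁻ _ _ t′∈
          X₃∈ , X₄∈ = ∈-cartesianProduct⁻ _ _ t″∈
      in cong₂ _,_ (∈-subsetsOfSize⇒size X₁∈) (cong₂ _,_ (∈-subsetsOfSize⇒size X₂∈)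
           (cong₂ _,_ (∈-subsetsOfSize⇒size X₃∈) (∈-subsetsOfSize⇒size X₄∈)))

  Unique-block : ∀ x₁ x₂ x₃ x₄ → Unique (block x₁ x₂ x₃ x₄)
  Unique-block x₁ x₂ x₃ x₄ with (x₁ + x₂ + x₃ + x₄) ≡ᵇ p
  ... | false = []
  ... | true = Unique.cartesianProduct⁺ (Unique-subsetsOfSize m₁ x₁)
                 (Unique.cartesianProduct⁺ (Unique-subsetsOfSize m₂ x₂)
                   (Unique.cartesianProduct⁺ (Unique-subsetsOfSize m₃ x₃) (Unique-subsetsOfSize m₄ x₄)))

  AdmissibleSizes : ℕ × ℕ × ℕ × ℕ → Set
  AdmissibleSizes (s₁ , s₂ , s₃ , s₄) =
    InRange u₁ s₁ × InRange u₂ s₂ × InRange u₃ s₃ × InRange u₄ s₄ × s₁ + s₂ + s₃ + s₄ ≡ p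

  All-admissible : All (AdmissibleSizes ∘ sizes) enumeration
  All-admissible =
    All-concatMap⁺ λ x₁∈ → All-concatMap⁺ λ x₂∈ → All-concatMap⁺ λ x₃∈ → All-concatMap⁺ λ x₄∈ →
      All.map (λ (sizes≡ , sum≡) → subst AdmissibleSizes (sym sizes≡)
                  (∈-range1⇒InRange x₁∈ , ∈-range1⇒InRange x₂∈ , ∈-range1⇒InRange x₃∈ ,
                   ∈-range1⇒InRange x₄∈ , sum≡))
              (All-InBlock _ _ _ _)

  keys₁ : ∀ x₁ → All (λ t → proj₁ (sizes t) ≡ x₁) (level₁ x₁)
  keys₁ x₁ =
    All-concatMap⁺ {f = level₂ x₁} {range1 u₂} λ {x₂} _ →
    All-concatMap⁺ {f = level₃ x₁ x₂} {range1 u₃} λ {x₃} _ →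
    All-concatMap⁺ {f = block x₁ x₂ x₃} {range1 u₄} λ {x₄} _ →
    All.map (cong proj₁ ∘ proj₁) (All-InBlock x₁ x₂ x₃ x₄)

  keys₂ : ∀ x₁ x₂ → All (λ t → proj₁ (proj₂ (sizes t)) ≡ x₂) (level₂ x₁ x₂)
  keys₂ x₁ x₂ =
    All-concatMap⁺ {f = level₃ x₁ x₂} {range1 u₃} λ {x₃} _ →
    All-concatMap⁺ {f = block x₁ x₂ x₃} {range1 u₄} λ {x₄} _ →
    All.map (cong (proj₁ ∘ proj₂) ∘ proj₁) (All-InBlock x₁ x₂ x₃ x₄)

  keys₃ : ∀ x₁ x₂ x₃ → All (λ t → proj₁ (proj₂ (proj₂ (sizes t))) ≡ x₃) (level₃ x₁ x₂ x₃)
  keys₃ x₁ x₂ x₃ = All-concatMap⁺ {f = block x₁ x₂ x₃} {range1 u₄} λ {x₄} _ →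
    All.map (cong (proj₁ ∘ proj₂ ∘ proj₂) ∘ proj₁) (All-InBlock x₁ x₂ x₃ x₄)

  keys₄ : ∀ x₁ x₂ x₃ x₄ → All (λ t → proj₂ (proj₂ (proj₂ (sizes t))) ≡ x₄) (block x₁ x₂ x₃ x₄)
  keys₄ x₁ x₂ x₃ x₄ = All.map (cong (proj₂ ∘ proj₂ ∘ proj₂) ∘ proj₁) (All-InBlock x₁ x₂ x₃ x₄)

  Unique-enumeration : Unique enumeration
  Unique-enumeration =
    Unique-concatMap⁺ (proj₁ ∘ sizes) (Unique-range1 u₁) (λ x₁ →
      Unique-concatMap⁺ (proj₁ ∘ proj₂ ∘ sizes) (Unique-range1 u₂) (λ x₂ →
        Unique-concatMap⁺ (proj₁ ∘ proj₂ ∘ proj₂ ∘ sizes) (Unique-range1 u₃) (λ x₃ →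
          Unique-concatMap⁺ (proj₂ ∘ proj₂ ∘ proj₂ ∘ sizes) (Unique-range1 u₄)
            (Unique-block x₁ x₂ x₃) (keys₄ x₁ x₂ x₃))
          (keys₃ x₁ x₂))
        (keys₂ x₁))
      keys₁

2≰1 : ¬ 2 ≤ 1
2≰1 (s≤s ())

module _ {n : ℕ} .{{_ : NonZero n}} (2≤n : 2 ≤ n) where

  suc-%≡%-suc : ∀ m → suc m % n ≡ suc (m % n) % n
  suc-%≡%-suc m = begin
    (1 + m) % n                ≡⟨ %-distribˡ-+ 1 m n ⟩
    (1 % n + m % n) % n        ≡⟨ cong (λ k → (k + m % n) % n) (m<n⇒m%n≡m 2≤n) ⟩
    suc (m % n) % n            ∎
    where open ≡-Reasoning

  %≢suc-% : ∀ m → m % n ≢ suc m % n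
  %≢suc-% m eq with suc (m % n) ℕ.<? n
  ... | yes 1+r<n = 1+n≢n (sym (trans eq (trans (suc-%≡%-suc m) (m<n⇒m%n≡m 1+r<n))))
  ... | no 1+r≮n with ≤-antisym (m%n<n m n) (≮⇒≥ 1+r≮n)
  ...   | 1+r≡n = 2≰1 (subst (2 ≤_) (trans (sym 1+r≡n) (cong suc r≡0)) 2≤n)
    where
    r≡0 : m % n ≡ 0
    r≡0 = trans eq (trans (suc-%≡%-suc m) (trans (cong (_% n) 1+r≡n) (n%n≡0 n)))

  ∃-%-suc-preimage : ∀ k → k < n → ∃[ m ] (m < n × suc m % n ≡ k × m ≢ k)
  ∃-%-suc-preimage zero _ =
    pred n , subst (pred n <_) (suc-pred n) ≤-refl ,
    trans (cong (_% n) (suc-pred n)) (n%n≡0 n) , pred[n]≢0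
    where
    pred[n]≢0 : pred n ≢ 0
    pred[n]≢0 eq = 2≰1 (subst (2 ≤_) (trans (sym (suc-pred n)) (cong suc eq)) 2≤n)
  ∃-%-suc-preimage (suc k) 1+k<n = k , <⇒≤ 1+k<n , m<n⇒m%n≡m 1+k<n , 1+n≢n ∘ sym

data Side : Set where
  left right : Side

data Kind : Set where
  large small : Kind

Block : Set
Block = Side × Kind

_≟-side_ : DecidableEquality Side
left ≟-side left = yes refl
left ≟-side right = no λ ()
right ≟-side left = no λ ()
right ≟-side right = yes refl

_≟-kind_ : DecidableEquality Kind
large ≟-kind large = yes refl
large ≟-kind small = no λ ()
small ≟-kind large = no λ ()
small ≟-kind small = yes refl

otherKind : Kind → Kind
otherKind large = small
otherKind small = large

next prev : Block → Block
next (left , κ) = right , κ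
next (right , κ) = left , otherKind κ
prev (left , κ) = right , otherKind κ
prev (right , κ) = left , κ

module Blocks (M N : ℕ) where

  kindSize : Kind → ℕ
  kindSize large = M
  kindSize small = N

  size : Block → ℕ
  size (_ , κ) = kindSize κ

  Slot : Set
  Slot = Σ Block (Fin ∘ size)

  _≟-slot_ : DecidableEquality Slot
  _≟-slot_ = Product.≡-dec (Product.≡-dec _≟-side_ _≟-kind_) _≟_

  Tuple : Set
  Tuple = Quadruple M M N N

  -- The component order matches the x₁, x₂, x₃, x₄ of Φgen.
  component : Tuple → (b : Block) → Subset (size b)
  component (X , _ , _ , _) (left , large) = X
  component (_ , X , _ , _) (right , large) = X
  component (_ , _ , X , _) (left , small) = X
  component (_ , _ , _ , X) (right , small) = X

  pointsTo : Tuple → Slot → Bool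
  pointsTo t (b , x) = lookup (component t b) x

  total : Tuple → ℕ
  total (X₁ , X₂ , X₃ , X₄) = ∣ X₁ ∣ + ∣ X₂ ∣ + ∣ X₃ ∣ + ∣ X₄ ∣

  toSubset : Tuple → Subset (M + (M + (N + N)))
  toSubset (X₁ , X₂ , X₃ , X₄) = X₁ Vec.++ X₂ Vec.++ X₃ Vec.++ X₄

  slotAt : Fin (M + (M + (N + N))) → Slot
  slotAt x with splitAt M x
  ... | inj₁ x₁ = (left , large) , x₁
  ... | inj₂ y with splitAt M y
  ...   | inj₁ x₂ = (right , large) , x₂
  ...   | inj₂ z with splitAt N z
  ...     | inj₁ x₃ = (left , small) , x₃
  ...     | inj₂ x₄ = (right , small) , x₄

  lookup-toSubset : ∀ t x → lookup (toSubset t) x ≡ pointsTo t (slotAt x)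
  lookup-toSubset (X₁ , X₂ , X₃ , X₄) x
    rewrite lookup-splitAt M X₁ (X₂ Vec.++ X₃ Vec.++ X₄) x with splitAt M x
  ... | inj₁ _ = refl
  ... | inj₂ y rewrite lookup-splitAt M X₂ (X₃ Vec.++ X₄) y with splitAt M y
  ...   | inj₁ _ = refl
  ...   | inj₂ z rewrite lookup-splitAt N X₃ X₄ z with splitAt N z
  ...     | inj₁ _ = refl
  ...     | inj₂ _ = refl

  ∣toSubset∣≡total : ∀ t → ∣ toSubset t ∣ ≡ total t
  ∣toSubset∣≡total (X₁ , X₂ , X₃ , X₄) = begin
    ∣ X₁ Vec.++ X₂ Vec.++ X₃ Vec.++ X₄ ∣             ≡⟨ ∣++∣ X₁ _ ⟩
    ∣ X₁ ∣ + ∣ X₂ Vec.++ X₃ Vec.++ X₄ ∣           ≡⟨ cong (∣ X₁ ∣ +_) (∣++∣ X₂ _) ⟩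
    ∣ X₁ ∣ + (∣ X₂ ∣ + ∣ X₃ Vec.++ X₄ ∣)       ≡⟨ cong (λ k → ∣ X₁ ∣ + (∣ X₂ ∣ + k)) (∣++∣ X₃ X₄) ⟩
    ∣ X₁ ∣ + (∣ X₂ ∣ + (∣ X₃ ∣ + ∣ X₄ ∣))  ≡⟨ +-assoc ∣ X₁ ∣ ∣ X₂ ∣ _ ⟨
    ∣ X₁ ∣ + ∣ X₂ ∣ + (∣ X₃ ∣ + ∣ X₄ ∣)    ≡⟨ +-assoc (∣ X₁ ∣ + ∣ X₂ ∣) ∣ X₃ ∣ _ ⟨
    ∣ X₁ ∣ + ∣ X₂ ∣ + ∣ X₃ ∣ + ∣ X₄ ∣      ∎
    where open ≡-Reasoning

  toSubset-injective : ∀ t t′ → toSubset t ≡ toSubset t′ → t ≡ t′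
  toSubset-injective (X₁ , X₂ , X₃ , X₄) (Y₁ , Y₂ , Y₃ , Y₄) eq
    with refl , eq′ ← ++-injective X₁ Y₁ eq
    with refl , eq″ ← ++-injective X₂ Y₂ eq′
    with refl , refl ← ++-injective X₃ Y₃ eq″ = refl

  ∃-distinguishingSlot : ∀ t t′ → t ≢ t′ → total t ≡ total t′ →
                         ∃[ s ] (pointsTo t s ≡ inside × pointsTo t′ s ≡ outside)
  ∃-distinguishingSlot t t′ t≢t′ same-total =
    let x , x∈t , x∉t′ =
          ∃-inside-outside (toSubset t) (toSubset t′) ∣t′∣≤∣t∣ (t≢t′ ∘ toSubset-injective t t′)
    in slotAt x , trans (sym (lookup-toSubset t x)) x∈t , trans (sym (lookup-toSubset t′ x)) x∉t′
    where
    ∣t′∣≤∣t∣ : ∣ toSubset t′ ∣ ≤ ∣ toSubset t ∣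
    ∣t′∣≤∣t∣ = subst₂ _≤_ (sym (∣toSubset∣≡total t′)) (sym (∣toSubset∣≡total t))
                        (≤-reflexive (sym same-total))

  -- Through the neighbouring blocks this puts every slot within distance two of the q-part
  -- vertex owning t, in both directions.
  Balanced : Tuple → Set
  Balanced t =
    (∀ b x → pointsTo t (b , x) ≡ inside → ∃[ x′ ] (pointsTo t (next b , x′) ≡ outside)) ×
    (∀ b x → pointsTo t (b , x) ≡ outside → ∃[ x′ ] (pointsTo t (prev b , x′) ≡ inside))

  AllProper : Tuple → Set
  AllProper t = ∀ b → Proper (component t b)

  AllProper⇒Balanced : ∀ {t} → AllProper t → Balanced t
  AllProper⇒Balanced {t} proper =
    (λ b _ _ → ∃-outside (component t (next b)) (proj₂ (proper (next b)))) ,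
    (λ b _ _ → ∃-inside (component t (prev b)) (proj₁ (proper (prev b))))

-- The tuples of the q-part

module TupleFamily {M N : ℕ} (2≤N : 2 ≤ N) (N≤M : N ≤ M) where

  open Blocks M N

  instance
    N-nonZero : NonZero N
    N-nonZero = >-nonZero (≤-trans (s≤s z≤n) 2≤N)

  1≤N : 1 ≤ N
  1≤N = ≤-trans (s≤s z≤n) 2≤N

  2≤M : 2 ≤ M
  2≤M = ≤-trans 2≤N N≤M

  index₀ : ∀ κ → Fin (kindSize κ)
  index₀ large = fromℕ< (≤-trans 1≤N N≤M)
  index₀ small = fromℕ< 1≤N

  full : Side → Tuple
  full left = ⊤ , ⊥ , ⊤ , ⊥
  full right = ⊥ , ⊤ , ⊥ , ⊤

  opposite : Side → Side
  opposite left = right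
  opposite right = left

  pointsTo-full-same : ∀ σ κ x → pointsTo (full σ) ((σ , κ) , x) ≡ inside
  pointsTo-full-same left large x = lookup-replicate x inside
  pointsTo-full-same left small x = lookup-replicate x inside
  pointsTo-full-same right large x = lookup-replicate x inside
  pointsTo-full-same right small x = lookup-replicate x inside

  pointsTo-full-opposite : ∀ σ κ x → pointsTo (full σ) ((opposite σ , κ) , x) ≡ outside
  pointsTo-full-opposite left large x = lookup-replicate x outside
  pointsTo-full-opposite left small x = lookup-replicate x outside
  pointsTo-full-opposite right large x = lookup-replicate x outside
  pointsTo-full-opposite right small x = lookup-replicate x outside

  Balanced-full : ∀ σ → Balanced (full σ)
  Balanced-full σ = leave σ , enter σ
    where
    leave : ∀ σ b x → pointsTo (full σ) (b , x) ≡ inside →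
            ∃[ x′ ] (pointsTo (full σ) (next b , x′) ≡ outside)
    leave left (left , κ) x _ = x , pointsTo-full-opposite left κ x
    leave right (right , κ) _ _ = index₀ (otherKind κ) , pointsTo-full-opposite right (otherKind κ) _
    leave left (right , κ) x h = ⊥-elim (true≢false (trans (sym h) (pointsTo-full-opposite left κ x)))
    leave right (left , κ) x h = ⊥-elim (true≢false (trans (sym h) (pointsTo-full-opposite right κ x)))
    enter : ∀ σ b x → pointsTo (full σ) (b , x) ≡ outside →
            ∃[ x′ ] (pointsTo (full σ) (prev b , x′) ≡ inside)
    enter left (right , κ) x _ = x , pointsTo-full-same left κ x
    enter right (left , κ) _ _ = index₀ (otherKind κ) , pointsTo-full-same right (otherKind κ) _
    enter left (left , κ) x h = ⊥-elim (true≢false (trans (sym (pointsTo-full-same left κ x)) h))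
    enter right (right , κ) x h = ⊥-elim (true≢false (trans (sym (pointsTo-full-same right κ x)) h))

  total-full : ∀ σ → total (full σ) ≡ M + N
  total-full left rewrite ∣⊤∣≡n M | ∣⊥∣≡0 M | ∣⊤∣≡n N | ∣⊥∣≡0 N =
    trans (+-identityʳ (M + 0 + N)) (cong (_+ N) (+-identityʳ M))
  total-full right rewrite ∣⊤∣≡n M | ∣⊥∣≡0 M | ∣⊤∣≡n N | ∣⊥∣≡0 N = cong (_+ N) (+-identityʳ M)

  ι : Fin N → Fin M
  ι y = inject≤ y N≤M

  -- Every x has two different partners and every y is a partner of two different x,
  -- which is what separation needs.
  partner₁ partner₂ : Fin M → Fin N
  partner₁ x = toℕ x mod N
  partner₂ x = suc (toℕ x) mod N

  partner₁-ι : ∀ y → partner₁ (ι y) ≡ y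
  partner₁-ι y = toℕ-injective (begin
    toℕ (partner₁ (ι y))  ≡⟨ toℕ-fromℕ< _ ⟩
    toℕ (ι y) % N      ≡⟨ cong (_% N) (toℕ-inject≤ y N≤M) ⟩
    toℕ y % N          ≡⟨ m<n⇒m%n≡m (toℕ<n y) ⟩
    toℕ y              ∎)
    where open ≡-Reasoning

  partner₁≢partner₂ : ∀ x → partner₁ x ≢ partner₂ x
  partner₁≢partner₂ x eq =
    %≢suc-% 2≤N (toℕ x) (trans (sym (toℕ-fromℕ< _)) (trans (cong toℕ eq) (toℕ-fromℕ< _)))

  ∃-partner₂-preimage : ∀ y → ∃[ ŷ ] (partner₂ (ι ŷ) ≡ y × ŷ ≢ y)
  ∃-partner₂-preimage y =
    let m , m<N , 1+m%N≡y , m≢y = ∃-%-suc-preimage 2≤N (toℕ y) (toℕ<n y)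
        ŷ = fromℕ< m<N
    in ŷ ,
       toℕ-injective (begin
         toℕ (partner₂ (ι ŷ))   ≡⟨ toℕ-fromℕ< _ ⟩
         suc (toℕ (ι ŷ)) % N  ≡⟨ cong (λ k → suc k % N) (trans (toℕ-inject≤ ŷ N≤M) (toℕ-fromℕ< m<N)) ⟩
         suc m % N            ≡⟨ 1+m%N≡y ⟩
         toℕ y                ∎) ,
       λ ŷ≡y → m≢y (trans (sym (toℕ-fromℕ< m<N)) (cong toℕ ŷ≡y))
    where open ≡-Reasoning

  core : Fin M → Fin N → Tuple
  core x y = ∁ ⁅ x ⁆ , ⁅ x ⁆ , ∁ ⁅ y ⁆ , ⁅ y ⁆

  cores : List Tuple
  cores = tabulate (λ x → core x (partner₁ x)) ++ tabulate (λ x → core x (partner₂ x))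

  SideSlot : Set
  SideSlot = Σ Kind (Fin ∘ kindSize)

  marks : Fin M → Fin N → SideSlot → Bool
  marks x y (large , z) = lookup ⁅ x ⁆ z
  marks x y (small , z) = lookup ⁅ y ⁆ z

  pointsTo-core-left : ∀ x y κ z → pointsTo (core x y) ((left , κ) , z) ≡ not (marks x y (κ , z))
  pointsTo-core-left x y large z = lookup-map z not ⁅ x ⁆
  pointsTo-core-left x y small z = lookup-map z not ⁅ y ⁆

  pointsTo-core-right : ∀ x y κ z → pointsTo (core x y) ((right , κ) , z) ≡ marks x y (κ , z)
  pointsTo-core-right x y large z = refl
  pointsTo-core-right x y small z = refl

  core-partner₁∈cores : ∀ x → core x (partner₁ x) ∈ cores
  core-partner₁∈cores x = ∈-++⁺ˡ (∈-tabulate⁺ x)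

  core-partner₂∈cores : ∀ x → core x (partner₂ x) ∈ cores
  core-partner₂∈cores x = ∈-++⁺ʳ _ (∈-tabulate⁺ x)

  separation : ∀ e e′ → e ≢ e′ →
               ∃[ x ] ∃[ y ] (core x y ∈ cores × marks x y e ≡ inside × marks x y e′ ≡ outside)
  separation (large , a) (large , a′) e≢e′ =
    a , partner₁ a , core-partner₁∈cores a , lookup-⁅⁆-self a ,
    lookup-⁅⁆-other (e≢e′ ∘ cong (large ,_) ∘ sym)
  separation (large , a) (small , y) _ with y ≟ partner₁ a
  ... | yes y≡partner₁ =
    a , partner₂ a , core-partner₂∈cores a , lookup-⁅⁆-self a ,
    lookup-⁅⁆-other (partner₁≢partner₂ a ∘ trans (sym y≡partner₁))
  ... | no y≢partner₁ =
    a , partner₁ a , core-partner₁∈cores a , lookup-⁅⁆-self a , lookup-⁅⁆-other y≢partner₁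
  separation (small , y) (small , y′) e≢e′ =
    ι y , partner₁ (ι y) , core-partner₁∈cores (ι y) ,
    subst (λ c → lookup ⁅ c ⁆ y ≡ inside) (sym (partner₁-ι y)) (lookup-⁅⁆-self y) ,
    subst (λ c → lookup ⁅ c ⁆ y′ ≡ outside) (sym (partner₁-ι y))
      (lookup-⁅⁆-other (e≢e′ ∘ cong (small ,_) ∘ sym))
  separation (small , y) (large , a) _ with a ≟ ι y
  ... | no a≢ιy =
    ι y , partner₁ (ι y) , core-partner₁∈cores (ι y) ,
    subst (λ c → lookup ⁅ c ⁆ y ≡ inside) (sym (partner₁-ι y)) (lookup-⁅⁆-self y) ,
    lookup-⁅⁆-other a≢ιy
  ... | yes a≡ιy =
    let ŷ , partner₂≡y , ŷ≢y = ∃-partner₂-preimage y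
    in ι ŷ , partner₂ (ι ŷ) , core-partner₂∈cores (ι ŷ) ,
       subst (λ c → lookup ⁅ c ⁆ y ≡ inside) (sym partner₂≡y) (lookup-⁅⁆-self y) ,
       lookup-⁅⁆-other (λ a≡ιŷ → ŷ≢y (inject≤-injective _ _ ŷ y (trans (sym a≡ιŷ) a≡ιy)))

  onSide : Side → SideSlot → Slot
  onSide σ (κ , z) = (σ , κ) , z

  separators : List Tuple
  separators = full left ∷ full right ∷ cores

  separatingTuple : ∀ s s′ → s ≢ s′ →
                    ∃[ t ] (t ∈ separators × pointsTo t s ≡ outside × pointsTo t s′ ≡ inside)
  separatingTuple ((left , κ) , z) ((right , κ′) , z′) _ =
    full right , there (here refl) , pointsTo-full-opposite right κ z , pointsTo-full-same right κ′ z′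
  separatingTuple ((right , κ) , z) ((left , κ′) , z′) _ =
    full left , here refl , pointsTo-full-opposite left κ z , pointsTo-full-same left κ′ z′
  separatingTuple ((left , κ) , z) ((left , κ′) , z′) s≢s′ =
    let x , y , core∈ , marks-s , marks-s′ = separation (κ , z) (κ′ , z′) (s≢s′ ∘ cong (onSide left))
    in core x y , there (there core∈) ,
       trans (pointsTo-core-left x y κ z) (cong not marks-s) ,
       trans (pointsTo-core-left x y κ′ z′) (cong not marks-s′)
  separatingTuple ((right , κ) , z) ((right , κ′) , z′) s≢s′ =
    let x , y , core∈ , marks-s′ , marks-s =
          separation (κ′ , z′) (κ , z) (s≢s′ ∘ sym ∘ cong (onSide right))
    in core x y , there (there core∈) ,
       trans (pointsTo-core-right x y κ z) marks-s , trans (pointsTo-core-right x y κ′ z′) marks-s′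

  AllProper-core : ∀ x y → AllProper (core x y)
  AllProper-core x y (left , large) = Proper-∁ {p = ⁅ x ⁆} (Proper-⁅⁆ 2≤M x)
  AllProper-core x y (right , large) = Proper-⁅⁆ 2≤M x
  AllProper-core x y (left , small) = Proper-∁ {p = ⁅ y ⁆} (Proper-⁅⁆ 2≤N y)
  AllProper-core x y (right , small) = Proper-⁅⁆ 2≤N y

  total-core : ∀ x y → total (core x y) ≡ M + N
  total-core x y rewrite ∣∁p∣≡n∸∣p∣ ⁅ x ⁆ | ∣∁p∣≡n∸∣p∣ ⁅ y ⁆ | ∣⁅x⁆∣≡1 x | ∣⁅x⁆∣≡1 y =
    trans (+-assoc (M ∸ 1 + 1) (N ∸ 1) 1)
          (cong₂ _+_ (m∸n+n≡m (≤-trans 1≤N N≤M)) (m∸n+n≡m 1≤N))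

  AllProper⇒≢full : ∀ {t} σ → AllProper t → t ≢ full σ
  AllProper⇒≢full left proper refl =
    ℕ.<-irrefl refl (subst (0 <_) (∣⊥∣≡0 M) (proj₁ (proper (right , large))))
  AllProper⇒≢full right proper refl =
    ℕ.<-irrefl refl (subst (0 <_) (∣⊥∣≡0 M) (proj₁ (proper (left , large))))

  core-injective : ∀ {x y x′ y′} → core x y ≡ core x′ y′ → x ≡ x′ × y ≡ y′
  core-injective eq =
    ⁅⁆-injective (cong (proj₁ ∘ proj₂) eq) , ⁅⁆-injective (cong (proj₂ ∘ proj₂ ∘ proj₂) eq)

  Unique-cores : Unique cores
  Unique-cores =
    Unique.++⁺ (Unique.tabulate⁺ (proj₁ ∘ core-injective)) (Unique.tabulate⁺ (proj₁ ∘ core-injective))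
               disjoint
    where
    disjoint : Disjoint (tabulate (λ x → core x (partner₁ x))) (tabulate (λ x → core x (partner₂ x)))
    disjoint (t∈₁ , t∈₂) with x , refl ← ∈-tabulate⁻ t∈₁ with x′ , eq ← ∈-tabulate⁻ t∈₂
      with refl , partner₁≡partner₂ ← core-injective eq = partner₁≢partner₂ x partner₁≡partner₂

  All-AllProper-cores : All AllProper cores
  All-AllProper-cores = All.++⁺ (All.tabulate⁺ λ x → AllProper-core x (partner₁ x))
                                (All.tabulate⁺ λ x → AllProper-core x (partner₂ x))

  Unique-separators : Unique separators
  Unique-separators =
    (left≢right ∷ All.map (λ proper → AllProper⇒≢full left proper ∘ sym) All-AllProper-cores) ∷
    All.map (λ proper → AllProper⇒≢full right proper ∘ sym) All-AllProper-cores ∷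
    Unique-cores
    where
    left≢right : full left ≢ full right
    left≢right eq with () ← trans (sym (pointsTo-full-same left large (index₀ large)))
                                 (trans (cong (λ t → pointsTo t ((left , large) , index₀ large)) eq)
                                        (pointsTo-full-opposite right large (index₀ large)))

  length-separators : length separators ≡ 2 + (M + M)
  length-separators =
    cong (2 +_) (trans (length-++ (tabulate (λ x → core x (partner₁ x))))
                       (cong₂ _+_ (length-tabulate (λ x → core x (partner₁ x)))
                                  (length-tabulate (λ x → core x (partner₂ x)))))

  _≟-tuple_ : DecidableEquality Tuple
  _≟-tuple_ = Product.≡-dec ≟ˢ (Product.≡-dec ≟ˢ (Product.≡-dec ≟ˢ ≟ˢ))
    where
    ≟ˢ : ∀ {n} → DecidableEquality (Subset n)
    ≟ˢ = Vec.≡-dec Bool._≟_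

  module Assignment (uM uN q : ℕ) (uM<M : uM < M) (uN<N : uN < N)
                    (2+2M≤q : 2 + (M + M) ≤ q) (q≤Φ+2 : q ≤ Φgen M M N N uM uM uN uN (M + N) + 2) where

    open Enumeration M M N N uM uM uN uN (M + N)
    open DecMembership _≟-tuple_ using (_∈?_)

    length-separators≤q : length separators ≤ q
    length-separators≤q = subst (_≤ q) (sym length-separators) 2+2M≤q

    AllProper-admissible : ∀ t → AdmissibleSizes (sizes t) → AllProper t
    AllProper-admissible _ (r₁ , _ , _ , _ , _) (left , large) = proj₁ r₁ , ≤-<-trans (proj₂ r₁) uM<M
    AllProper-admissible _ (_ , r₂ , _ , _ , _) (right , large) = proj₁ r₂ , ≤-<-trans (proj₂ r₂) uM<M
    AllProper-admissible _ (_ , _ , r₃ , _ , _) (left , small) = proj₁ r₃ , ≤-<-trans (proj₂ r₃) uN<N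
    AllProper-admissible _ (_ , _ , _ , r₄ , _) (right , small) = proj₁ r₄ , ≤-<-trans (proj₂ r₄) uN<N

    total-admissible : ∀ t → AdmissibleSizes (sizes t) → total t ≡ M + N
    total-admissible _ (_ , _ , _ , _ , sum≡) = sum≡

    others : List Tuple
    others = filter (λ t → ¬? (t ∈? separators)) enumeration

    tuples : List Tuple
    tuples = separators ++ others

    Unique-tuples : Unique tuples
    Unique-tuples =
      Unique.++⁺ Unique-separators (Unique.filter⁺ (λ t → ¬? (t ∈? separators)) Unique-enumeration)
        λ (t∈separators , t∈others) →
          proj₂ (∈-filter⁻ (λ t → ¬? (t ∈? separators)) {xs = enumeration} t∈others) t∈separators

    All-Balanced-tuples : All Balanced tuples
    All-Balanced-tuples = Balanced-full left ∷ Balanced-full right ∷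
      All.++⁺ (All.map AllProper⇒Balanced All-AllProper-cores)
              (All.filter⁺ _ (All.map (λ {t} → AllProper⇒Balanced ∘ AllProper-admissible t) All-admissible))

    All-total-tuples : All (λ t → total t ≡ M + N) tuples
    All-total-tuples = total-full left ∷ total-full right ∷
      All.++⁺ (All.++⁺ (All.tabulate⁺ λ x → total-core x (partner₁ x))
                       (All.tabulate⁺ λ x → total-core x (partner₂ x)))
              (All.filter⁺ _ (All.map (λ {t} → total-admissible t) All-admissible))

    AllProper-enumerated : ∀ {t} → t ∈ enumeration → AllProper t
    AllProper-enumerated {t} t∈ = AllProper-admissible t (All.lookup All-admissible t∈)

    enumeration⊆cores++others : ∀ {t} → t ∈ enumeration → t ∈ cores ++ others
    enumeration⊆cores++others {t} t∈ with t ∈? separators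
    ... | no t∉separators = ∈-++⁺ʳ cores (∈-filter⁺ (λ t → ¬? (t ∈? separators)) t∈ t∉separators)
    ... | yes (here refl) = ⊥-elim (AllProper⇒≢full left (AllProper-enumerated t∈) refl)
    ... | yes (there (here refl)) = ⊥-elim (AllProper⇒≢full right (AllProper-enumerated t∈) refl)
    ... | yes (there (there t∈cores)) = ∈-++⁺ˡ t∈cores

    q≤length-tuples : q ≤ length tuples
    q≤length-tuples = begin
      q                                    ≤⟨ q≤Φ+2 ⟩
      Φgen M M N N uM uM uN uN (M + N) + 2 ≡⟨ cong (_+ 2) length-enumeration ⟨
      length enumeration + 2               ≤⟨ +-monoˡ-≤ 2 enumeration≤ ⟩
      length (cores ++ others) + 2         ≡⟨ +-comm _ 2 ⟩
      length tuples                        ∎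
      where
      open ≤-Reasoning
      enumeration≤ : length enumeration ≤ length (cores ++ others)
      enumeration≤ = Unique⇒length≤ Unique-enumeration enumeration⊆cores++others

    assignment : Fin q → Tuple
    assignment k = List.lookup tuples (inject≤ k q≤length-tuples)

    assignment∈tuples : ∀ k → assignment k ∈ tuples
    assignment∈tuples k = ∈-lookup (inject≤ k q≤length-tuples)

    Balanced-assignment : ∀ k → Balanced (assignment k)
    Balanced-assignment k = All.lookup All-Balanced-tuples (assignment∈tuples k)

    distinguishingSlot : ∀ k k′ → k ≢ k′ →
                         ∃[ s ] (pointsTo (assignment k) s ≡ inside × pointsTo (assignment k′) s ≡ outside)
    distinguishingSlot k k′ k≢k′ =
      ∃-distinguishingSlot (assignment k) (assignment k′)
        (k≢k′ ∘ inject≤-injective _ _ k k′ ∘ Unique⇒lookup-injective Unique-tuples)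
        (trans (All.lookup All-total-tuples (assignment∈tuples k))
               (sym (All.lookup All-total-tuples (assignment∈tuples k′))))

    assignment-separator : ∀ {t} (t∈ : t ∈ separators) →
      assignment (inject≤ (Any.index t∈) length-separators≤q) ≡ t
    assignment-separator {t} t∈ = begin
      List.lookup tuples (inject≤ (inject≤ (Any.index t∈) _) q≤length-tuples)
        ≡⟨ cong (List.lookup tuples) (inject≤-idempotent (Any.index t∈) _ _ _) ⟩
      List.lookup (separators ++ others) (inject≤ (Any.index t∈) (length-++-≤ˡ separators))
        ≡⟨ lookup-++-inject≤ separators others (Any.index t∈) (length-++-≤ˡ separators) ⟩
      List.lookup separators (Any.index t∈)
        ≡⟨ lookup-index t∈ ⟨
      t ∎
      where open ≡-Reasoning

    separatingVertex : ∀ s s′ → s ≢ s′ →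
                       ∃[ k ] (pointsTo (assignment k) s ≡ outside × pointsTo (assignment k) s′ ≡ inside)
    separatingVertex s s′ s≢s′ =
      let t , t∈ , s-out , s′-in = separatingTuple s s′ s≢s′
          k = inject≤ (Any.index t∈) length-separators≤q
      in k , subst (λ t → pointsTo t s ≡ outside) (sym (assignment-separator t∈)) s-out ,
             subst (λ t → pointsTo t s′ ≡ inside) (sym (assignment-separator t∈)) s′-in

-- The orientation

<?-total : ∀ {m} (i i′ : Fin m) → i ≢ i′ → does (i <? i′) ≡ true ⊎ does (i′ <? i) ≡ true
<?-total i i′ i≢i′ with <-cmp i i′
... | tri< i<i′ _ _ = inj₁ (dec-true (i <? i′) i<i′)
... | tri≈ _ i≡i′ _ = ⊥-elim (i≢i′ i≡i′)
... | tri> _ _ i′<i = inj₂ (dec-true (i′ <? i) i′<i)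

<?-asym : ∀ {m} (i i′ : Fin m) → does (i <? i′) ≡ true → does (i′ <? i) ≢ true
<?-asym i i′ arc arc′ with <-cmp i i′
... | tri< _ _ i′≮i = true≢false (trans (sym arc′) (dec-false (i′ <? i) i′≮i))
... | tri≈ i≮i′ _ _ = true≢false (trans (sym arc) (dec-false (i <? i′) i≮i′))
... | tri> i≮i′ _ _ = true≢false (trans (sym arc) (dec-false (i <? i′) i≮i′))

module _ {M N : ℕ} where

  open Blocks M N

  module Orientation
    {V : Set} {m : ℕ} (part : V → Fin m) {q : ℕ} (label : V ↔ (Slot ⊎ Fin q))
    (sameSide : ∀ {u v b b′ x x′} → Inverse.to label u ≡ inj₁ (b , x) → Inverse.to label v ≡ inj₁ (b′ , x′) →
                part u ≡ part v → proj₁ b ≡ proj₁ b′)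
    (vertexPart : ∀ {u v k k′} → Inverse.to label u ≡ inj₂ k → Inverse.to label v ≡ inj₂ k′ →
                  part u ≡ part v)
    (slot≁vertex : ∀ {u v s k} → Inverse.to label u ≡ inj₁ s → Inverse.to label v ≡ inj₂ k →
                   part u ≢ part v)
    (assignment : Fin q → Tuple)
    (Balanced-assignment : ∀ k → Balanced (assignment k))
    (distinguishingSlot : ∀ k k′ → k ≢ k′ →
       ∃[ s ] (pointsTo (assignment k) s ≡ inside × pointsTo (assignment k′) s ≡ outside))
    (separatingVertex : ∀ s s′ → s ≢ s′ →
       ∃[ k ] (pointsTo (assignment k) s ≡ outside × pointsTo (assignment k) s′ ≡ inside))
    where

    open Inverse label using (to; from) renaming (strictlyInverseˡ to to∘from; strictlyInverseʳ to from∘to)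

    Adj : V → V → Set
    Adj u v = part u ≢ part v

    slotArc : Block → Fin m → Block → Fin m → Bool
    slotArc (left , _) i (left , _) i′ = does (i <? i′)
    slotArc (right , _) i (right , _) i′ = does (i <? i′)
    slotArc (left , κ) _ (right , κ′) _ = does (κ ≟-kind κ′)
    slotArc (right , κ) _ (left , κ′) _ = not (does (κ′ ≟-kind κ))

    labelArc : Slot ⊎ Fin q → Slot ⊎ Fin q → Fin m → Fin m → Bool
    labelArc (inj₁ (b , _)) (inj₁ (b′ , _)) i i′ = slotArc b i b′ i′
    labelArc (inj₁ s) (inj₂ k) _ _ = not (pointsTo (assignment k) s)
    labelArc (inj₂ k) (inj₁ s) _ _ = pointsTo (assignment k) s
    labelArc (inj₂ _) (inj₂ _) _ _ = false

    D : Digraph V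
    D u v = labelArc (to u) (to v) (part u) (part v)

    slotArc-total : ∀ b b′ i i′ → i ≢ i′ → slotArc b i b′ i′ ≡ true ⊎ slotArc b′ i′ b i ≡ true
    slotArc-total (left , _) (left , _) i i′ i≢i′ = <?-total i i′ i≢i′
    slotArc-total (right , _) (right , _) i i′ i≢i′ = <?-total i i′ i≢i′
    slotArc-total (left , κ) (right , κ′) _ _ _ with does (κ ≟-kind κ′)
    ... | true = inj₁ refl
    ... | false = inj₂ refl
    slotArc-total (right , κ) (left , κ′) _ _ _ with does (κ′ ≟-kind κ)
    ... | true = inj₂ refl
    ... | false = inj₁ refl

    slotArc-asym : ∀ b b′ i i′ → slotArc b i b′ i′ ≡ true → slotArc b′ i′ b i ≢ true
    slotArc-asym (left , _) (left , _) i i′ = <?-asym i i′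
    slotArc-asym (right , _) (right , _) i i′ = <?-asym i i′
    slotArc-asym (left , κ) (right , κ′) _ _ arc arc′ = not-¬ (sym arc) (sym arc′)
    slotArc-asym (right , κ) (left , κ′) _ _ arc arc′ = not-¬ (sym arc′) (sym arc)

    slotArc-irreflexive : ∀ b b′ i → proj₁ b ≡ proj₁ b′ → slotArc b i b′ i ≢ true
    slotArc-irreflexive (left , _) (left , _) i _ arc = true≢false (trans (sym arc) (dec-false (i <? i) (<-irrefl refl)))
    slotArc-irreflexive (right , _) (right , _) i _ arc = true≢false (trans (sym arc) (dec-false (i <? i) (<-irrefl refl)))

    oriented : ∀ u v → Adj u v → Arc D u v ⊎ Arc D v u
    oriented u v u≁v with to u in eu | to v in ev
    ... | inj₁ (b , _) | inj₁ (b′ , _) = slotArc-total b b′ (part u) (part v) u≁v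
    ... | inj₁ s | inj₂ k with pointsTo (assignment k) s
    ...   | true = inj₂ refl
    ...   | false = inj₁ refl
    oriented u v u≁v | inj₂ k | inj₁ s with pointsTo (assignment k) s
    ...   | true = inj₁ refl
    ...   | false = inj₂ refl
    oriented u v u≁v | inj₂ _ | inj₂ _ = ⊥-elim (u≁v (vertexPart eu ev))

    arc⇒adj : ∀ u v → Arc D u v → Adj u v
    arc⇒adj u v arc same-part with to u in eu | to v in ev
    ... | inj₁ (b , _) | inj₁ (b′ , _) =
      slotArc-irreflexive b b′ (part u) (sameSide eu ev same-part)
        (subst (λ i → slotArc b (part u) b′ i ≡ true) (sym same-part) arc)
    ... | inj₁ _ | inj₂ _ = slot≁vertex eu ev same-part
    ... | inj₂ _ | inj₁ _ = slot≁vertex ev eu (sym same-part)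

    asymmetric : ∀ u v → Arc D u v → ¬ Arc D v u
    asymmetric u v arc arc′ with to u | to v
    ... | inj₁ (b , _) | inj₁ (b′ , _) = slotArc-asym b b′ (part u) (part v) arc arc′
    ... | inj₁ _ | inj₂ _ = not-¬ (sym arc′) (sym arc)
    ... | inj₂ _ | inj₁ _ = not-¬ (sym arc) (sym arc′)

    slotArc-next : ∀ b i i′ → slotArc b i (next b) i′ ≡ true
    slotArc-next (left , large) _ _ = refl
    slotArc-next (left , small) _ _ = refl
    slotArc-next (right , large) _ _ = refl
    slotArc-next (right , small) _ _ = refl

    slotArc-prev : ∀ b i i′ → slotArc (prev b) i b i′ ≡ true
    slotArc-prev (left , large) _ _ = refl
    slotArc-prev (left , small) _ _ = refl
    slotArc-prev (right , large) _ _ = refl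
    slotArc-prev (right , small) _ _ = refl

    arc-next : ∀ {u v b x x′} → to u ≡ inj₁ (b , x) → to v ≡ inj₁ (next b , x′) → Arc D u v
    arc-next {u} {v} {b} eu ev rewrite eu | ev = slotArc-next b (part u) (part v)

    arc-prev : ∀ {u v b x x′} → to u ≡ inj₁ (prev b , x′) → to v ≡ inj₁ (b , x) → Arc D u v
    arc-prev {u} {v} {b} eu ev rewrite eu | ev = slotArc-prev b (part u) (part v)

    arc-into : ∀ {u w s k} → to u ≡ inj₁ s → to w ≡ inj₂ k → pointsTo (assignment k) s ≡ outside → Arc D u w
    arc-into eu ew s-out rewrite eu | ew = cong not s-out

    arc-out : ∀ {w v k s} → to w ≡ inj₂ k → to v ≡ inj₁ s → pointsTo (assignment k) s ≡ inside → Arc D w v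
    arc-out ew ev s-in rewrite ew | ev = s-in

    Within2 : V → V → Set
    Within2 u v = ∃[ m ] (m ≤ 2 × Walk D m u v)

    path0 : ∀ {u v} → u ≡ v → Within2 u v
    path0 refl = 0 , z≤n , here

    path1 : ∀ {u v} → Arc D u v → Within2 u v
    path1 uv = 1 , s≤s z≤n , step uv here

    path2 : ∀ {u w v} → Arc D u w → Arc D w v → Within2 u v
    path2 uw wv = 2 , ≤-refl , step uw (step wv here)

    same-label : ∀ {u v ℓ} → to u ≡ ℓ → to v ≡ ℓ → u ≡ v
    same-label {u} {v} eu ev = trans (sym (from∘to u)) (trans (cong from (trans eu (sym ev))) (from∘to v))

    within2 : ∀ u v → Within2 u v
    within2 u v with to u in eu | to v in ev
    ... | inj₁ s | inj₁ s′ with s ≟-slot s′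
    ...   | yes refl = path0 (same-label eu ev)
    ...   | no s≢s′ with k , s-out , s′-in ← separatingVertex s s′ s≢s′ =
      path2 (arc-into eu (to∘from _) s-out) (arc-out (to∘from _) ev s′-in)
    within2 u v | inj₁ (b , x) | inj₂ k with pointsTo (assignment k) (b , x) in e
    ... | false = path1 (arc-into eu ev e)
    ... | true with x′ , x′-out ← proj₁ (Balanced-assignment k) b x e =
      path2 (arc-next eu (to∘from (inj₁ (next b , x′)))) (arc-into (to∘from _) ev x′-out)
    within2 u v | inj₂ k | inj₁ (b , x) with pointsTo (assignment k) (b , x) in e
    ... | true = path1 (arc-out eu ev e)
    ... | false with x′ , x′-in ← proj₂ (Balanced-assignment k) b x e =
      path2 (arc-out eu (to∘from _) x′-in) (arc-prev (to∘from (inj₁ (prev b , x′))) ev)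
    within2 u v | inj₂ k | inj₂ k′ with k ≟ k′
    ... | yes refl = path0 (same-label eu ev)
    ... | no k≢k′ with s , s-in , s-out ← distinguishingSlot k k′ k≢k′ =
      path2 (arc-out eu (to∘from (inj₁ s)) s-in) (arc-into (to∘from _) ev s-out)

    orientationNumber : Slot → Fin q → OrientationNumber Adj 2
    orientationNumber s k =
      orientationNumber≡2 (λ ne → ne refl) D
        (slot≁vertex (to∘from (inj₁ s)) (to∘from (inj₂ k)))
        (oriented , arc⇒adj , asymmetric) within2

-- Vertices of K(p₁,…,p_n,q)

↑ˡ≢↑ʳ : ∀ {m n} (i : Fin m) (j : Fin n) → i ↑ˡ n ≢ m ↑ʳ j
↑ˡ≢↑ʳ {m} {n} i j eq with () ← trans (sym (splitAt-↑ˡ m i n)) (trans (cong (splitAt m) eq) (splitAt-↑ʳ m n j))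

MPVertex-≡ : ∀ {m} {sizes : Fin m → ℕ} {u v : MPVertex sizes} →
             proj₁ u ≡ proj₁ v → toℕ (proj₂ u) ≡ toℕ (proj₂ v) → u ≡ v
MPVertex-≡ {u = i , _} {.i , _} refl eq = cong (i ,_) (toℕ-injective eq)

toℕ-subst : ∀ {A : Set} {f : A → ℕ} {a b : A} (e : a ≡ b) (j : Fin (f a)) → toℕ (subst (Fin ∘ f) e j) ≡ toℕ j
toℕ-subst refl j = refl

module _ {m n : ℕ} (xs : Fin m → ℕ) (ys : Fin n → ℕ) where

  private
    size : Fin m ⊎ Fin n → ℕ
    size = [ xs , ys ]′

    classify : (s : Fin m ⊎ Fin n) → Fin (size s) → MPVertex xs ⊎ MPVertex ys
    classify (inj₁ a) j = inj₁ (a , j)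
    classify (inj₂ b) j = inj₂ (b , j)

    join : MPVertex xs ⊎ MPVertex ys → MPVertex (xs Vector.++ ys)
    join (inj₁ (a , j)) = a ↑ˡ n , subst (Fin ∘ size) (sym (splitAt-↑ˡ m a n)) j
    join (inj₂ (b , j)) = m ↑ʳ b , subst (Fin ∘ size) (sym (splitAt-↑ʳ m n b)) j

    classify-subst : ∀ {s s′} (e : s ≡ s′) j → classify s (subst (Fin ∘ size) (sym e) j) ≡ classify s′ j
    classify-subst refl j = refl

    join-classify : ∀ i s (e : splitAt m i ≡ s) (j : Fin (size s)) →
                    join (classify s j) ≡ (i , subst (Fin ∘ size) (sym e) j)
    join-classify i (inj₁ a) e j with refl ← splitAt⁻¹-↑ˡ e =
      MPVertex-≡ refl (trans (toℕ-subst _ j) (sym (toℕ-subst (sym e) j)))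
    join-classify i (inj₂ b) e j with refl ← splitAt⁻¹-↑ʳ e =
      MPVertex-≡ refl (trans (toℕ-subst _ j) (sym (toℕ-subst (sym e) j)))

  MPVertex-++↔ : MPVertex (xs Vector.++ ys) ↔ (MPVertex xs ⊎ MPVertex ys)
  MPVertex-++↔ = mk↔ₛ′ (λ (i , j) → classify (splitAt m i) j) join classify∘join
                       (λ (i , j) → join-classify i (splitAt m i) refl j)
    where
    classify∘join : ∀ w → classify (splitAt m (proj₁ (join w))) (proj₂ (join w)) ≡ w
    classify∘join (inj₁ (a , j)) = classify-subst (splitAt-↑ˡ m a n) j
    classify∘join (inj₂ (b , j)) = classify-subst (splitAt-↑ʳ m n b) j

MPVertex-single↔ : ∀ q → MPVertex {1} (λ _ → q) ↔ Fin q
MPVertex-single↔ q = mk↔ₛ′ proj₂ (zero ,_) (λ _ → refl) λ { (zero , k) → refl }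

flatten : ∀ {n} (sizes : Fin n → ℕ) → MPVertex sizes → Fin (sum (tabulate sizes))
flatten sizes (zero , j) = j ↑ˡ _
flatten sizes (suc a , j) = sizes zero ↑ʳ flatten (sizes ∘ suc) (a , j)

unflatten : ∀ {n} (sizes : Fin n → ℕ) → Fin (sum (tabulate sizes)) → MPVertex sizes
unflatten {suc n} sizes g with splitAt (sizes zero) g
... | inj₁ j = zero , j
... | inj₂ g′ = Product.map suc id (unflatten (sizes ∘ suc) g′)

flatten↔ : ∀ {n} (sizes : Fin n → ℕ) → MPVertex sizes ↔ Fin (sum (tabulate sizes))
flatten↔ sizes =
  mk↔ₛ′ (flatten sizes) (unflatten sizes) (flatten∘unflatten sizes) (unflatten∘flatten sizes)
  where
  flatten∘unflatten : ∀ {n} (sizes : Fin n → ℕ) g → flatten sizes (unflatten sizes g) ≡ g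
  flatten∘unflatten {suc n} sizes g with splitAt (sizes zero) g in eq
  ... | inj₁ j = splitAt⁻¹-↑ˡ eq
  ... | inj₂ g′ = trans (cong (sizes zero ↑ʳ_) (flatten∘unflatten (sizes ∘ suc) g′)) (splitAt⁻¹-↑ʳ eq)
  unflatten∘flatten : ∀ {n} (sizes : Fin n → ℕ) v → unflatten sizes (flatten sizes v) ≡ v
  unflatten∘flatten {suc n} sizes (zero , j)
    rewrite splitAt-↑ˡ (sizes zero) j (sum (tabulate (sizes ∘ suc))) = refl
  unflatten∘flatten {suc n} sizes (suc a , j)
    rewrite splitAt-↑ʳ (sizes zero) (sum (tabulate (sizes ∘ suc))) (flatten (sizes ∘ suc) (a , j))
    = cong (Product.map suc id) (unflatten∘flatten (sizes ∘ suc) (a , j))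

toℕ-flatten : ∀ {n} (sizes : Fin n → ℕ) a j → toℕ (flatten sizes (a , j)) ≡ prefixSum sizes (toℕ a) + toℕ j
toℕ-flatten sizes zero j = toℕ-↑ˡ j _
toℕ-flatten sizes (suc a) j = begin
  toℕ (sizes zero ↑ʳ flatten (sizes ∘ suc) (a , j))          ≡⟨ toℕ-↑ʳ (sizes zero) _ ⟩
  sizes zero + toℕ (flatten (sizes ∘ suc) (a , j))           ≡⟨ cong (sizes zero +_) (toℕ-flatten (sizes ∘ suc) a j) ⟩
  sizes zero + (prefixSum (sizes ∘ suc) (toℕ a) + toℕ j)     ≡⟨ +-assoc (sizes zero) _ (toℕ j) ⟨
  sizes zero + prefixSum (sizes ∘ suc) (toℕ a) + toℕ j       ∎
  where open ≡-Reasoning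

prefixSum-suc : ∀ {n} (sizes : Fin n → ℕ) a → prefixSum sizes (suc (toℕ a)) ≡ prefixSum sizes (toℕ a) + sizes a
prefixSum-suc sizes zero = +-comm (sizes zero) 0
prefixSum-suc sizes (suc a) =
  trans (cong (sizes zero +_) (prefixSum-suc (sizes ∘ suc) a)) (sym (+-assoc (sizes zero) _ _))

prefixSum-mono : ∀ {n} (sizes : Fin n → ℕ) {i i′} → i ≤ i′ → prefixSum sizes i ≤ prefixSum sizes i′
prefixSum-mono {zero} sizes {zero} _ = z≤n
prefixSum-mono {zero} sizes {suc i} _ = z≤n
prefixSum-mono {suc n} sizes {zero} _ = z≤n
prefixSum-mono {suc n} sizes {suc i} {suc i′} (s≤s i≤i′) = +-monoʳ-≤ (sizes zero) (prefixSum-mono (sizes ∘ suc) i≤i′)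

prefixSum+suffixSum : ∀ {n} (sizes : Fin n → ℕ) r → prefixSum sizes r + suffixSum sizes r ≡ sum (tabulate sizes)
prefixSum+suffixSum sizes r =
  trans (sym (sum-++ (take r (tabulate sizes)) _)) (cong sum (take++drop≡id r (tabulate sizes)))

cast↔ : ∀ {m n} → m ≡ n → Fin m ↔ Fin n
cast↔ eq = mk↔ₛ′ (cast eq) (cast (sym eq)) (cast-involutive eq (sym eq)) (cast-involutive (sym eq) eq)

module Positions (M N : ℕ) where
  open Blocks M N

  private
    toSlot : Side → Fin M ⊎ Fin N → Slot
    toSlot σ (inj₁ x) = (σ , large) , x
    toSlot σ (inj₂ y) = (σ , small) , y

    side-toSlot : ∀ σ h → proj₁ (proj₁ (toSlot σ h)) ≡ σ
    side-toSlot σ (inj₁ _) = refl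
    side-toSlot σ (inj₂ _) = refl

    fromSlot : Slot → (Fin M ⊎ Fin N) ⊎ (Fin M ⊎ Fin N)
    fromSlot ((left , large) , x) = inj₁ (inj₁ x)
    fromSlot ((left , small) , y) = inj₁ (inj₂ y)
    fromSlot ((right , large) , x) = inj₂ (inj₁ x)
    fromSlot ((right , small) , y) = inj₂ (inj₂ y)

    halves↔slots : ((Fin M ⊎ Fin N) ⊎ (Fin M ⊎ Fin N)) ↔ Slot
    halves↔slots = mk↔ₛ′ [ toSlot left , toSlot right ]′ fromSlot
      (λ { ((left , large) , _) → refl ; ((left , small) , _) → refl
         ; ((right , large) , _) → refl ; ((right , small) , _) → refl })
      (λ { (inj₁ (inj₁ _)) → refl ; (inj₁ (inj₂ _)) → refl
         ; (inj₂ (inj₁ _)) → refl ; (inj₂ (inj₂ _)) → refl })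

  positions↔slots : Fin ((M + N) + (M + N)) ↔ Slot
  positions↔slots = halves↔slots ↔-∘ ((+↔⊎ ⊎-↔ +↔⊎) ↔-∘ +↔⊎)

  sideAt : Fin ((M + N) + (M + N)) → Side
  sideAt g = proj₁ (proj₁ (Inverse.to positions↔slots g))

  sideAt-< : ∀ g → toℕ g < M + N → sideAt g ≡ left
  sideAt-< g g<M+N rewrite splitAt-< (M + N) g g<M+N = side-toSlot left (splitAt M (fromℕ< g<M+N))

  sideAt-≥ : ∀ g → M + N ≤ toℕ g → sideAt g ≡ right
  sideAt-≥ g M+N≤g rewrite splitAt-≥ (M + N) g M+N≤g = side-toSlot right (splitAt M (reduce≥ g M+N≤g))

module Labelling {n : ℕ} (ps : Fin n → ℕ) (q : ℕ) {M N r : ℕ}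
                 (prefix≡ : prefixSum ps r ≡ M + N) (suffix≡ : suffixSum ps r ≡ M + N) where

  open Blocks M N
  open Positions M N

  position↔ : MPVertex ps ↔ Fin ((M + N) + (M + N))
  position↔ = cast↔ (trans (sym (prefixSum+suffixSum ps r)) (cong₂ _+_ prefix≡ suffix≡)) ↔-∘ flatten↔ ps

  label : MPVertex (KSizes ps q) ↔ (Slot ⊎ Fin q)
  label = ((positions↔slots ↔-∘ position↔) ⊎-↔ MPVertex-single↔ q) ↔-∘ MPVertex-++↔ ps (λ _ → q)

  open Inverse label using (to; from; strictlyInverseʳ)

  part≡ : ∀ {u ℓ} → to u ≡ ℓ → proj₁ u ≡ proj₁ (from ℓ)
  part≡ {u} eu = cong proj₁ (trans (sym (strictlyInverseʳ u)) (cong from eu))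

  parts≡ : ∀ {u v ℓ ℓ′} → to u ≡ ℓ → to v ≡ ℓ′ → proj₁ u ≡ proj₁ v → proj₁ (from ℓ) ≡ proj₁ (from ℓ′)
  parts≡ eu ev same-part = trans (sym (part≡ eu)) (trans same-part (part≡ ev))

  -- The side of a vertex depends only on its part: the first r parts fill exactly the
  -- first p = M + N positions.
  sideOf : Fin n → Side
  sideOf a with toℕ a ℕ.<? r
  ... | yes _ = left
  ... | no _ = right

  sideAt-position : ∀ a j → sideAt (Inverse.to position↔ (a , j)) ≡ sideOf a
  sideAt-position a j with toℕ a ℕ.<? r
  ... | yes a<r = sideAt-< _ (begin-strict
    toℕ (Inverse.to position↔ (a , j))   ≡⟨ toℕ-position ⟩
    prefixSum ps (toℕ a) + toℕ j        <⟨ +-monoʳ-< (prefixSum ps (toℕ a)) (toℕ<n j) ⟩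
    prefixSum ps (toℕ a) + ps a         ≡⟨ prefixSum-suc ps a ⟨
    prefixSum ps (suc (toℕ a))          ≤⟨ prefixSum-mono ps a<r ⟩
    prefixSum ps r                      ≡⟨ prefix≡ ⟩
    M + N                               ∎)
    where open ≤-Reasoning
          toℕ-position : toℕ (Inverse.to position↔ (a , j)) ≡ prefixSum ps (toℕ a) + toℕ j
          toℕ-position = trans (toℕ-cast _ _) (toℕ-flatten ps a j)
  ... | no a≮r = sideAt-≥ _ (begin
    M + N                               ≡⟨ prefix≡ ⟨
    prefixSum ps r                      ≤⟨ prefixSum-mono ps (≮⇒≥ a≮r) ⟩
    prefixSum ps (toℕ a)                ≤⟨ m≤m+n _ (toℕ j) ⟩
    prefixSum ps (toℕ a) + toℕ j        ≡⟨ trans (toℕ-cast _ _) (toℕ-flatten ps a j) ⟨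
    toℕ (Inverse.to position↔ (a , j))   ∎)
    where open ≤-Reasoning

  side≡sideOf : ∀ s →
    proj₁ (proj₁ s) ≡ sideOf (proj₁ (Inverse.from position↔ (Inverse.from positions↔slots s)))
  side≡sideOf s = begin
    proj₁ (proj₁ s)                   ≡⟨ cong (proj₁ ∘ proj₁) (Inverse.strictlyInverseˡ positions↔slots s) ⟨
    sideAt g                          ≡⟨ cong sideAt (Inverse.strictlyInverseˡ position↔ g) ⟨
    sideAt (Inverse.to position↔ v)   ≡⟨ sideAt-position (proj₁ v) (proj₂ v) ⟩
    sideOf (proj₁ v)                  ∎
    where
    open ≡-Reasoning
    g : Fin ((M + N) + (M + N))
    g = Inverse.from positions↔slots s
    v : MPVertex ps
    v = Inverse.from position↔ g

  sameSide : ∀ {u v b b′ x x′} → to u ≡ inj₁ (b , x) → to v ≡ inj₁ (b′ , x′) →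
             proj₁ u ≡ proj₁ v → proj₁ b ≡ proj₁ b′
  sameSide {b = b} {b′} {x} {x′} eu ev same-part = begin
    proj₁ b     ≡⟨ side≡sideOf (b , x) ⟩
    sideOf _    ≡⟨ cong sideOf (↑ˡ-injective 1 _ _ (parts≡ eu ev same-part)) ⟩
    sideOf _    ≡⟨ side≡sideOf (b′ , x′) ⟨
    proj₁ b′    ∎
    where open ≡-Reasoning

  vertexPart : ∀ {u v k k′} → to u ≡ inj₂ k → to v ≡ inj₂ k′ → proj₁ u ≡ proj₁ v
  vertexPart eu ev = trans (part≡ eu) (sym (part≡ ev))

  slot≁vertex : ∀ {u v s k} → to u ≡ inj₁ s → to v ≡ inj₂ k → proj₁ u ≢ proj₁ v
  slot≁vertex eu ev same-part = ↑ˡ≢↑ʳ _ zero (parts≡ eu ev same-part)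

orientationNumber-K≡2 : ∀ {n} (ps : Fin n → ℕ) (q : ℕ) {M N uM uN r : ℕ} →
  2 ≤ N → N ≤ M → uM < M → uN < N →
  prefixSum ps r ≡ M + N → suffixSum ps r ≡ M + N →
  2 + (M + M) ≤ q → q ≤ Φgen M M N N uM uM uN uN (M + N) + 2 →
  OrientationNumber (MPAdj (KSizes ps q)) 2
orientationNumber-K≡2 ps q {M} {N} {uM} {uN} {r} 2≤N N≤M uM<M uN<N prefix≡ suffix≡ 2+2M≤q q≤Φ+2 =
  Orientation.orientationNumber proj₁ label sameSide vertexPart slot≁vertex
    assignment Balanced-assignment distinguishingSlot separatingVertex
    ((left , large) , index₀ large) (fromℕ< (≤-trans (s≤s z≤n) 2+2M≤q))
  where
  open Labelling ps q {M} {N} {r} prefix≡ suffix≡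
  open TupleFamily 2≤N N≤M
  open Assignment uM uN q uM<M uN<N 2+2M≤q q≤Φ+2

even⇒half+half : ∀ p → p % 2 ≡ 0 → p ≡ p / 2 + p / 2
even⇒half+half p p%2≡0 = begin
  p                        ≡⟨ m≡m%n+[m/n]*n p 2 ⟩
  p % 2 + p / 2 * 2        ≡⟨ cong (λ r → r + p / 2 * 2) p%2≡0 ⟩
  0 + p / 2 * 2            ≡⟨ double (p / 2) ⟩
  p / 2 + p / 2            ∎
  where
  open ≡-Reasoning
  double : ∀ h → 0 + h * 2 ≡ h + h
  double = solve-∀

odd⇒half+1+half : ∀ p → p % 2 ≡ 1 → p ≡ (p / 2 + 1) + p / 2
odd⇒half+1+half p p%2≡1 = begin
  p                        ≡⟨ m≡m%n+[m/n]*n p 2 ⟩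
  p % 2 + p / 2 * 2        ≡⟨ cong (λ r → r + p / 2 * 2) p%2≡1 ⟩
  1 + p / 2 * 2            ≡⟨ double+1 (p / 2) ⟩
  (p / 2 + 1) + p / 2      ∎
  where
  open ≡-Reasoning
  double+1 : ∀ h → 1 + h * 2 ≡ (h + 1) + h
  double+1 = solve-∀

2≤half-even : ∀ h → 4 ≤ h + h → 2 ≤ h
2≤half-even (suc (suc _)) _ = s≤s (s≤s z≤n)
2≤half-even 1 (s≤s (s≤s ()))

2≤half-odd : ∀ x → 4 ≤ (x + 1) + x → 2 ≤ x
2≤half-odd (suc (suc _)) _ = s≤s (s≤s z≤n)
2≤half-odd 0 (s≤s ())
2≤half-odd 1 (s≤s (s≤s (s≤s ())))

∸1< : ∀ {h} → 1 ≤ h → h ∸ 1 < h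
∸1< {suc h} _ = n<1+n h

corollary3p12 : (n : ℕ) → 2 ≤ n → (ps : Fin n → ℕ) → (∀ i → 1 ≤ ps i) →
    (p q : ℕ) → (∃[ r ] (prefixSum ps r ≡ p × suffixSum ps r ≡ p)) → 4 ≤ p →
    ((p % 2 ≡ 0 × p + 2 ≤ q × q ≤ Φeven p + 2) ⊎
     (p % 2 ≡ 1 × p + 3 ≤ q × q ≤ Φodd p + 2)) →
    OrientationNumber (MPAdj (KSizes ps q)) 2
corollary3p12 _ _ ps _ p q (r , prefix≡p , suffix≡p) 4≤p (inj₁ (p%2≡0 , p+2≤q , q≤Φ+2)) =
  orientationNumber-K≡2 ps q {r = r} 2≤h ≤-refl (∸1< 1≤h) (∸1< 1≤h)
    (trans prefix≡p p≡h+h) (trans suffix≡p p≡h+h)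
    (subst (_≤ q) (trans (cong (_+ 2) p≡h+h) (+-comm (h + h) 2)) p+2≤q)
    (subst (λ p′ → q ≤ Φgen h h h h (h ∸ 1) (h ∸ 1) (h ∸ 1) (h ∸ 1) p′ + 2) p≡h+h q≤Φ+2)
  where
  h : ℕ
  h = p / 2
  p≡h+h : p ≡ h + h
  p≡h+h = even⇒half+half p p%2≡0
  2≤h : 2 ≤ h
  2≤h = 2≤half-even h (subst (4 ≤_) p≡h+h 4≤p)
  1≤h : 1 ≤ h
  1≤h = ≤-trans (s≤s z≤n) 2≤h
corollary3p12 _ _ ps _ p q (r , prefix≡p , suffix≡p) 4≤p (inj₂ (p%2≡1 , p+3≤q , q≤Φ+2)) =
  orientationNumber-K≡2 ps q {r = r} 2≤x (m≤m+n x 1) (m<m+n x (s≤s z≤n))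
    (∸1< (≤-trans (s≤s z≤n) 2≤x))
    (trans prefix≡p p≡x+1+x) (trans suffix≡p p≡x+1+x)
    (subst (_≤ q) (trans (cong (_+ 3) p≡x+1+x) (rearrange x)) p+3≤q)
    (subst (λ p′ → q ≤ Φgen (x + 1) (x + 1) x x x x (x ∸ 1) (x ∸ 1) p′ + 2) p≡x+1+x q≤Φ+2)
  where
  x : ℕ
  x = p / 2
  p≡x+1+x : p ≡ (x + 1) + x
  p≡x+1+x = odd⇒half+1+half p p%2≡1
  2≤x : 2 ≤ x
  2≤x = 2≤half-odd x (subst (4 ≤_) p≡x+1+x 4≤p)
  rearrange : ∀ x → (x + 1) + x + 3 ≡ 2 + ((x + 1) + (x + 1))
  rearrange = solve-∀
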